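{- Let $R$ be a unique factorization domain with quotient field $Q(R)$, let $f(s)=\frac{a_m}{m^s}+\cdots+\frac{a_n}{n^s}$ be an algebraically primitive Dirichlet polynomial with coefficients in $R$, $a_ma_n\neq0$, let $p$ be a prime element of $R$, and let $q_1,\dots,q_k$ be all the prime factors of $m\cdot n$. If (i) $\nu_p(a_n)\neq\nu_p(a_m)$, (ii) $\left(\frac{n}{i}\right)^{\nu_p(a_i)-\nu_p(a_m)}>\left(\frac{m}{i}\right)^{\nu_p(a_i)-\nu_p(a_n)}$ for $m<i<n$, (iii) $\gcd(\nu_p(a_n)-\nu_p(a_m),\ \nu_{q_1}(n)-\nu_{q_1}(m),\dots,\nu_{q_k}(n)-\nu_{q_k}(m))=1$, then $f$ is irreducible over $Q(R)$.
   Context: Dirichlet polynomials $\sum_i \frac{a_i}{i^s}$ are multiplied by the Dirichlet product $\left(\sum_j\frac{b_j}{j^s}\right)\left(\sum_k\frac{c_k}{k^s}\right)=\sum_i\frac{\sum_{jk=i}b_jc_k}{i^s}$; constant means supported on $\{1\}$; algebraically primitive means the indices $i$ with $a_i\neq0$ have gcd $1$. $\nu_p$ is the $p$-adic valuation, with $\nu_p(0)=+\infty$ (so condition (ii) only concerns $i$ with $a_i\ne 0$). Irreducible over $Q(R)$: not a product of two nonconstant Dirichlet polynomials with coefficients in $Q(R)$. -}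

module Defs where

open import Level using (Level; _⊔_)
open import Algebra.Bundles using (CommutativeRing)
open import Algebra.Morphism.Structures using (module RingMorphisms)
open import Data.Nat as ℕ using (ℕ; zero; suc; _<_; _≤_; _^_)
open import Data.Nat.Divisibility as ℕD using (_∣?_)
open import Data.Nat.DivMod using (_/_)
open import Data.Integer as ℤ using (ℤ; +_; -[1+_])
open import Data.Rational as ℚ using (ℚ)
open import Data.List using (List; foldr; length)
open import Data.List.Relation.Unary.All using (All)
open import Data.Fin using (Fin; cast)
open import Data.Fin.Permutation using (Permutation′; _⟨$⟩ʳ_)
open import Data.List using (lookup)
open import Data.Product using (Σ; ∃; ∃₂; _×_)
open import Data.Sum using (_⊎_)
open import Relation.Nullary using (¬_; yes; no)
open import Relation.Binary.PropositionalEquality using (_≡_)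

module _ {c ℓ : Level} (R : CommutativeRing c ℓ) where
  open CommutativeRing R

  Divides : Carrier → Carrier → Set (c ⊔ ℓ)
  Divides a b = ∃ λ x → b ≈ x * a

  IsUnit : Carrier → Set (c ⊔ ℓ)
  IsUnit a = ∃ λ u → a * u ≈ 1#

  pow : Carrier → ℕ → Carrier
  pow a zero    = 1#
  pow a (suc k) = a * pow a k

  IsIntegralDomain : Set (c ⊔ ℓ)
  IsIntegralDomain = (¬ (1# ≈ 0#)) × (∀ a b → a * b ≈ 0# → a ≈ 0# ⊎ b ≈ 0#)

  IsIrreducibleElt : Carrier → Set (c ⊔ ℓ)
  IsIrreducibleElt a =
    (¬ (a ≈ 0#)) × (¬ IsUnit a) × (∀ b d → a ≈ b * d → IsUnit b ⊎ IsUnit d)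

  IsPrimeElt : Carrier → Set (c ⊔ ℓ)
  IsPrimeElt p =
    (¬ (p ≈ 0#)) × (¬ IsUnit p) × (∀ a b → Divides p (a * b) → Divides p a ⊎ Divides p b)

  Associated : Carrier → Carrier → Set (c ⊔ ℓ)
  Associated a b = ∃ λ u → IsUnit u × (a ≈ u * b)

  prodL : List Carrier → Carrier
  prodL = foldr _*_ 1#

  record IsUFD : Set (c ⊔ ℓ) where
    field
      domain : IsIntegralDomain
      factor-exists : ∀ a → ¬ (a ≈ 0#) → ¬ IsUnit a →
        ∃ λ (xs : List Carrier) → All IsIrreducibleElt xs × (prodL xs ≈ a)
      factor-unique : ∀ (xs ys : List Carrier) →
        All IsIrreducibleElt xs → All IsIrreducibleElt ys → prodL xs ≈ prodL ys →
        Σ (length xs ≡ length ys) λ eq →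
          ∃ λ (σ : Permutation′ (length xs)) →
            ∀ i → Associated (lookup xs i) (lookup ys (cast eq (σ ⟨$⟩ʳ i)))

  HasVal : Carrier → Carrier → ℕ → Set (c ⊔ ℓ)
  HasVal p a k = Divides (pow p k) a × (¬ Divides (pow p (suc k)) a)

module _ {c ℓ c' ℓ' : Level} (R : CommutativeRing c ℓ) (K : CommutativeRing c' ℓ') where
  private
    module R = CommutativeRing R
    module K = CommutativeRing K
  open RingMorphisms R.rawRing K.rawRing using (IsRingHomomorphism)

  record IsFractionField (ι : R.Carrier → K.Carrier) : Set (c ⊔ ℓ ⊔ c' ⊔ ℓ') where
    field
      homo      : IsRingHomomorphism ι
      injective : ∀ a b → ι a K.≈ ι b → a R.≈ b
      inverses  : ∀ b → ¬ (b R.≈ R.0#) → ∃ λ y → ι b K.* y K.≈ K.1#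
      fractions : ∀ x → ∃₂ λ a b → (¬ (b R.≈ R.0#)) × (x K.* ι b K.≈ ι a)

-- Dirichlet polynomials over a commutative ring K, as coefficient functions
-- ℕ → K (index i ≥ 1 is the coefficient of 1/i^s; index 0 is ignored).

module _ {c ℓ : Level} (K : CommutativeRing c ℓ) where
  open CommutativeRing K

  dsum : (ℕ → Carrier) → (ℕ → Carrier) → ℕ → ℕ → Carrier
  dsum g h i zero = 0#
  dsum g h i (suc k) with suc k ∣? i
  ... | yes _ = dsum g h i k + g (suc k) * h (i / suc k)
  ... | no  _ = dsum g h i k

  dmul : (ℕ → Carrier) → (ℕ → Carrier) → ℕ → Carrier
  dmul g h i = dsum g h i i

  IsDirichletPoly : (ℕ → Carrier) → Set ℓ
  IsDirichletPoly g = ∃ λ N → ∀ i → N < i → g i ≈ 0#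

  IsNonconstant : (ℕ → Carrier) → Set ℓ
  IsNonconstant g = ∃ λ i → 2 ≤ i × (¬ (g i ≈ 0#))

  IrreducibleOver : (ℕ → Carrier) → Set (c ⊔ ℓ)
  IrreducibleOver f = ¬ (∃₂ λ g h →
    IsDirichletPoly g × IsDirichletPoly h × IsNonconstant g × IsNonconstant h ×
    (∀ i → 1 ≤ i → f i ≈ dmul g h i))

HasValℕ : ℕ → ℕ → ℕ → Set
HasValℕ q n k = (q ^ k) ℕD.∣ n × (¬ ((q ^ suc k) ℕD.∣ n))

frac : ℕ → ℕ → ℚ
frac a zero    = ℚ.0ℚ
frac a (suc b) = ℤ.+ a ℚ./ suc b

qpow : ℚ → ℕ → ℚ
qpow x zero    = ℚ.1ℚ
qpow x (suc k) = x ℚ.* qpow x k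

-- zpow a b e = (a / b)^e for an integer exponent e (intended for a, b ≥ 1)
zpow : ℕ → ℕ → ℤ → ℚ
zpow a b (+ k)     = qpow (frac a b) k
zpow a b -[1+ k ]  = qpow (frac b a) (suc k)

-- After clearing denominators, a factorisation of f over Q(R) becomes B·f = G·H with G and H
-- over R.  Give a term c/i^s with c ≠ 0 the weight ν_p(c)·log(n/m) - (ν_p(a_n) - ν_p(a_m))·log i:
-- weights add under the Dirichlet product, the two end terms of f have equal weight, and by
-- (ii) every other term of f is heavier.  Let T_G, T_H be the rightmost lightest terms of G
-- and H.  Every other product of terms of G and H with index T_G·T_H is heavier, hence has
-- larger valuation, so the coefficient of B·f at T_G·T_H is nonzero and exactly as light as
-- the two lightest terms together; so these are no lighter than the end terms of B·f.  The
-- latter are products of the end terms of G and H, so the first and last terms of G (and of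
-- H) are lightest too.  Comparing q-adic valuations in the equality of their weights for
-- every prime q, (iii) shows that ν_p(a_n) - ν_p(a_m) divides the difference of the
-- valuations of the end coefficients of G, which however is nonzero and smaller in absolute
-- value.  Primitivity of f guarantees that G and H have at least two terms each.  Zero tests
-- and valuations in R are not decidable; they are needed for finitely many coefficients only
-- and the goal is a negation, so excluded middle provides them.

module Submission where

open import Defs
open import Level using (Level; _⊔_)
open import Algebra.Bundles using (CommutativeRing)
open import Algebra.Morphism.Structures using (module RingMorphisms)
import Algebra.Properties.Ring as RingProperties
import Algebra.Solver.CommutativeMonoid as CommutativeMonoidSolver
open import Data.Nat as ℕ using (ℕ; zero; suc; z≤n; s≤s; NonZero)
import Data.Nat.Properties as ℕ
import Data.Nat.Divisibility as ℕ
open import Data.Nat.Divisibility using (_∣?_)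
open import Data.Nat.DivMod using (_/_; m*[n/m]≡n; m/n*n≡m)
open import Data.Nat.Primality using (Prime; euclidsLemma; prime⇒nonZero; prime⇒nonTrivial)
open import Data.Product using (∃; ∃₂; _×_; _,_; proj₁; proj₂)
open import Data.Sum using (_⊎_; inj₁; inj₂; [_,_]′)
open import Data.Empty using (⊥)
open import Function using (_∘_)
open import Relation.Nullary using (¬_; Dec; yes; no)
open import Relation.Nullary.Decidable using (map′; _×-dec_; ¬¬-excluded-middle)
open import Relation.Nullary.Negation using (contradiction; DoubleNegation; ¬¬-Monad; ¬¬-map)
open import Relation.Unary using (Pred; Decidable)
open import Relation.Binary.PropositionalEquality as ≡ using (_≡_; _≢_)
open import Effect.Monad using (RawMonad)
open import Data.Integer using (_⊖_)
import Data.Rational as ℚ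

-- Divisibility and valuations in integral domains

module DividesProperties {c ℓ : Level} (R : CommutativeRing c ℓ) where
  open CommutativeRing R
  open import Relation.Binary.Reasoning.Setoid setoid
  open CommutativeMonoidSolver *-commutativeMonoid using (solve; _⊕_; _⊜_)
  open RingProperties ring using (-‿distribˡ-*)

  infix 4 _∣_
  infixr 8 _^_

  _∣_ : Carrier → Carrier → Set (c ⊔ ℓ)
  _∣_ = Divides R

  _^_ : Carrier → ℕ → Carrier
  _^_ = pow R

  ∣-respʳ : ∀ {d x y} → x ≈ y → d ∣ x → d ∣ y
  ∣-respʳ x≈y (k , x≈kd) = k , trans (sym x≈y) x≈kd

  ∣-respˡ : ∀ {d e x} → d ≈ e → d ∣ x → e ∣ x
  ∣-respˡ d≈e (k , x≈kd) = k , trans x≈kd (*-congˡ d≈e)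

  _∣0 : ∀ d → d ∣ 0#
  d ∣0 = 0# , sym (zeroˡ d)

  ∣-+ : ∀ {d x y} → d ∣ x → d ∣ y → d ∣ x + y
  ∣-+ {d} {x} {y} (k , x≈kd) (l , y≈ld) = k + l , (begin
    x + y          ≈⟨ +-cong x≈kd y≈ld ⟩
    k * d + l * d  ≈⟨ distribʳ d k l ⟨
    (k + l) * d    ∎)

  ∣-neg : ∀ {d x} → d ∣ x → d ∣ - x
  ∣-neg {d} (k , x≈kd) = - k , trans (-‿cong x≈kd) (-‿distribˡ-* k d)

  ∣-trans : ∀ {d e x} → d ∣ e → e ∣ x → d ∣ x
  ∣-trans {d} {e} {x} (k , e≈kd) (l , x≈le) = l * k , (begin
    x            ≈⟨ x≈le ⟩
    l * e        ≈⟨ *-congˡ e≈kd ⟩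
    l * (k * d)  ≈⟨ *-assoc l k d ⟨
    l * k * d    ∎)

  *-∣-* : ∀ {d e x y} → d ∣ x → e ∣ y → d * e ∣ x * y
  *-∣-* {d} {e} {x} {y} (k , x≈kd) (l , y≈le) = k * l , (begin
    x * y              ≈⟨ *-cong x≈kd y≈le ⟩
    (k * d) * (l * e)  ≈⟨ solve 4 (λ k d l e → (k ⊕ d) ⊕ (l ⊕ e) ⊜ (k ⊕ l) ⊕ (d ⊕ e)) refl k d l e ⟩
    (k * l) * (d * e)  ∎)

  ^-+ : ∀ x a b → x ^ (a ℕ.+ b) ≈ x ^ a * x ^ b
  ^-+ x zero    b = sym (*-identityˡ _)
  ^-+ x (suc a) b = trans (*-congˡ (^-+ x a b)) (sym (*-assoc x (x ^ a) (x ^ b)))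

  ^-∣-^ : ∀ x {a b} → a ℕ.≤ b → x ^ a ∣ x ^ b
  ^-∣-^ x {a} a≤b with ℕ.m≤n⇒∃[o]m+o≡n a≤b
  ... | o , ≡.refl = x ^ o , trans (^-+ x a o) (*-comm _ _)

  ^-∣-*-^ : ∀ x {a b u v} → x ^ a ∣ u → x ^ b ∣ v → x ^ (a ℕ.+ b) ∣ u * v
  ^-∣-*-^ x {a} {b} du dv = ∣-respˡ (sym (^-+ x a b)) (*-∣-* du dv)

module IntegralDomainProperties {c ℓ : Level} (R : CommutativeRing c ℓ) (dom : IsIntegralDomain R) where
  open CommutativeRing R
  open import Relation.Binary.Reasoning.Setoid setoid
  open RingProperties ring using ([y-z]x≈yx-zx)
  open CommutativeMonoidSolver *-commutativeMonoid using (solve; _⊕_; _⊜_)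
  open DividesProperties R using (_^_)

  *-≉0 : ∀ {x y} → ¬ (x ≈ 0#) → ¬ (y ≈ 0#) → ¬ (x * y ≈ 0#)
  *-≉0 x≉0 y≉0 xy≈0 with proj₂ dom _ _ xy≈0
  ... | inj₁ x≈0 = x≉0 x≈0
  ... | inj₂ y≈0 = y≉0 y≈0

  ^-≉0 : ∀ {x} k → ¬ (x ≈ 0#) → ¬ (x ^ k ≈ 0#)
  ^-≉0 zero    x≉0 = proj₁ dom
  ^-≉0 (suc k) x≉0 = *-≉0 x≉0 (^-≉0 k x≉0)

  *-cancelʳ : ∀ {x y z} → ¬ (z ≈ 0#) → x * z ≈ y * z → x ≈ y
  *-cancelʳ {x} {y} {z} z≉0 xz≈yz with proj₂ dom (x - y) z (begin
      (x - y) * z    ≈⟨ [y-z]x≈yx-zx z x y ⟩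
      x * z - y * z  ≈⟨ +-congʳ xz≈yz ⟩
      y * z - y * z  ≈⟨ -‿inverseʳ _ ⟩
      0#             ∎)
  ... | inj₂ z≈0   = contradiction z≈0 z≉0
  ... | inj₁ x-y≈0 = begin
    x              ≈⟨ +-identityʳ x ⟨
    x + 0#         ≈⟨ +-congˡ (-‿inverseˡ y) ⟨
    x + (- y + y)  ≈⟨ +-assoc x (- y) y ⟨
    (x - y) + y    ≈⟨ +-congʳ x-y≈0 ⟩
    0# + y         ≈⟨ +-identityˡ y ⟩
    y              ∎

  prime⇒irreducible : ∀ {p} → IsPrimeElt R p → IsIrreducibleElt R p
  prime⇒irreducible {p} (p≉0 , p-nonunit , p-prime) = p≉0 , p-nonunit , factors
    where
    factors : ∀ b d → p ≈ b * d → IsUnit R b ⊎ IsUnit R d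
    factors b d p≈bd with p-prime b d (1# , trans (sym p≈bd) (sym (*-identityˡ p)))
    ... | inj₁ (t , b≈tp) = inj₂ (t , sym (*-cancelʳ p≉0 (begin
      1# * p       ≈⟨ *-identityˡ p ⟩
      p            ≈⟨ p≈bd ⟩
      b * d        ≈⟨ *-congʳ b≈tp ⟩
      (t * p) * d  ≈⟨ solve 3 (λ t p d → (t ⊕ p) ⊕ d ⊜ (d ⊕ t) ⊕ p) refl t p d ⟩
      (d * t) * p  ∎)))
    ... | inj₂ (t , d≈tp) = inj₁ (t , sym (*-cancelʳ p≉0 (begin
      1# * p       ≈⟨ *-identityˡ p ⟩
      p            ≈⟨ p≈bd ⟩
      b * d        ≈⟨ *-congˡ d≈tp ⟩
      b * (t * p)  ≈⟨ *-assoc b t p ⟨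
      (b * t) * p  ∎)))

module PAdicValuation {c ℓ : Level} (R : CommutativeRing c ℓ) (dom : IsIntegralDomain R)
                      (p : CommutativeRing.Carrier R) (prime : IsPrimeElt R p) where
  open CommutativeRing R
  open import Relation.Binary.Reasoning.Setoid setoid
  open CommutativeMonoidSolver *-commutativeMonoid using (solve; _⊕_; _⊜_)
  open DividesProperties R
  open IntegralDomainProperties R dom

  infix 4 ν[_]≡_

  -- HasVal as a record, so that the exponent is inferable from a valuation.
  record ν[_]≡_ (x : Carrier) (v : ℕ) : Set (c ⊔ ℓ) where
    constructor valuation
    field
      divides     : p ^ v ∣ x
      not-divides : ¬ (p ^ suc v ∣ x)

  HasVal⇒ν : ∀ {x v} → HasVal R p x v → ν[ x ]≡ v
  HasVal⇒ν (pᵛ∣x , pᵛ⁺¹∤x) = valuation pᵛ∣x pᵛ⁺¹∤x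

  ν⇒HasVal : ∀ {x v} → ν[ x ]≡ v → HasVal R p x v
  ν⇒HasVal (valuation pᵛ∣x pᵛ⁺¹∤x) = pᵛ∣x , pᵛ⁺¹∤x

  ^∣⇒≤ν : ∀ {x u v} → p ^ u ∣ x → ν[ x ]≡ v → u ℕ.≤ v
  ^∣⇒≤ν pᵘ∣x (valuation _ pᵛ⁺¹∤x) = ℕ.≮⇒≥ λ v<u → pᵛ⁺¹∤x (∣-trans (^-∣-^ p v<u) pᵘ∣x)

  ν-unique : ∀ {x u v} → ν[ x ]≡ u → ν[ x ]≡ v → u ≡ v
  ν-unique νx≡u νx≡v = ℕ.≤-antisym (^∣⇒≤ν (ν[_]≡_.divides νx≡u) νx≡v) (^∣⇒≤ν (ν[_]≡_.divides νx≡v) νx≡u)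

  ν-resp : ∀ {x y v} → x ≈ y → ν[ x ]≡ v → ν[ y ]≡ v
  ν-resp x≈y (valuation pᵛ∣x pᵛ⁺¹∤x) =
    valuation (∣-respʳ x≈y pᵛ∣x) λ pᵛ⁺¹∣y → pᵛ⁺¹∤x (∣-respʳ (sym x≈y) pᵛ⁺¹∣y)

  ν⇒≉0 : ∀ {x v} → ν[ x ]≡ v → ¬ (x ≈ 0#)
  ν⇒≉0 {v = v} (valuation _ pᵛ⁺¹∤x) x≈0 = pᵛ⁺¹∤x (∣-respʳ (sym x≈0) ((p ^ suc v) ∣0))

  ν-+ : ∀ {x r v} → ν[ x ]≡ v → p ^ suc v ∣ r → ν[ x + r ]≡ v
  ν-+ {x} {r} {v} (valuation pᵛ∣x pᵛ⁺¹∤x) pᵛ⁺¹∣r = valuation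
    (∣-+ pᵛ∣x (∣-trans (^-∣-^ p (ℕ.n≤1+n v)) pᵛ⁺¹∣r))
    λ pᵛ⁺¹∣x+r → pᵛ⁺¹∤x (∣-respʳ x+r-r≈x (∣-+ pᵛ⁺¹∣x+r (∣-neg pᵛ⁺¹∣r)))
    where
    x+r-r≈x : (x + r) - r ≈ x
    x+r-r≈x = begin
      (x + r) - r  ≈⟨ +-assoc x r (- r) ⟩
      x + (r - r)  ≈⟨ +-congˡ (-‿inverseʳ r) ⟩
      x + 0#       ≈⟨ +-identityʳ x ⟩
      x            ∎

  ν-* : ∀ {x y a b} → ν[ x ]≡ a → ν[ y ]≡ b → ν[ x * y ]≡ a ℕ.+ b
  ν-* {x} {y} {a} {b} (valuation pᵃ∣x@(x′ , x≈x′pᵃ) pᵃ⁺¹∤x) (valuation pᵇ∣y@(y′ , y≈y′pᵇ) pᵇ⁺¹∤y) =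
    valuation (^-∣-*-^ p {a} {b} pᵃ∣x pᵇ∣y) pᵃ⁺ᵇ⁺¹∤xy
    where
    pᵃ⁺ᵇ⁺¹∤xy : ¬ (p ^ suc (a ℕ.+ b) ∣ x * y)
    pᵃ⁺ᵇ⁺¹∤xy (k , xy≈kp¹⁺ᵃ⁺ᵇ) with proj₂ (proj₂ prime) x′ y′ (k , *-cancelʳ (^-≉0 (a ℕ.+ b) (proj₁ prime)) (begin
        (x′ * y′) * p ^ (a ℕ.+ b)        ≈⟨ *-congˡ (^-+ p a b) ⟩
        (x′ * y′) * (p ^ a * p ^ b)
          ≈⟨ solve 4 (λ x y u v → (x ⊕ y) ⊕ (u ⊕ v) ⊜ (x ⊕ u) ⊕ (y ⊕ v)) refl x′ y′ (p ^ a) (p ^ b) ⟩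
        (x′ * p ^ a) * (y′ * p ^ b)      ≈⟨ *-cong x≈x′pᵃ y≈y′pᵇ ⟨
        x * y                            ≈⟨ xy≈kp¹⁺ᵃ⁺ᵇ ⟩
        k * (p * p ^ (a ℕ.+ b))          ≈⟨ *-assoc k p _ ⟨
        (k * p) * p ^ (a ℕ.+ b)          ∎))
    ... | inj₁ (t , x′≈tp) = pᵃ⁺¹∤x (t , trans x≈x′pᵃ (trans (*-congʳ x′≈tp) (*-assoc t p (p ^ a))))
    ... | inj₂ (t , y′≈tp) = pᵇ⁺¹∤y (t , trans y≈y′pᵇ (trans (*-congʳ y′≈tp) (*-assoc t p (p ^ b))))

  Valued : (ℕ → Carrier) → Set (c ⊔ ℓ)
  Valued F = ∀ j → F j ≈ 0# ⊎ ∃ λ v → ν[ F j ]≡ v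

¬¬-∀-bounded : ∀ {p} {P : Pred ℕ p} N → (∀ i → N ℕ.< i → P i) → (∀ i → DoubleNegation (P i)) →
               DoubleNegation (∀ i → P i)
¬¬-∀-bounded {p} {P} N large each = ¬¬-map extend (below (suc N))
  where
  open RawMonad (¬¬-Monad {p})
  below : ∀ M → DoubleNegation (∀ i → i ℕ.< M → P i)
  below zero    = pure λ _ ()
  below (suc M) = below M >>= λ small → each M >>= λ at → pure λ i i<1+M →
    [ small i , (λ { ≡.refl → at }) ]′ (ℕ.m<1+n⇒m<n∨m≡n i<1+M)
  extend : (∀ i → i ℕ.< suc N → P i) → ∀ i → P i
  extend small i with i ℕ.≤? N
  ... | yes i≤N = small i (s≤s i≤N)
  ... | no  i≰N = large i (ℕ.≰⇒> i≰N)

module ValuationExistence {c ℓ : Level} (R : CommutativeRing c ℓ) (ufd : IsUFD R)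
                          (p : CommutativeRing.Carrier R) (prime : IsPrimeElt R p) where
  open CommutativeRing R
  open import Relation.Binary.Reasoning.Setoid setoid
  open import Data.List using ([]; _∷_; _++_; replicate; length)
  import Data.List.Properties as List
  open import Data.List.Relation.Unary.All using (All)
  import Data.List.Relation.Unary.All.Properties as All
  open RawMonad (¬¬-Monad {c ⊔ ℓ}) using (pure; _>>=_)
  open CommutativeMonoidSolver *-commutativeMonoid using (solve; _⊕_; _⊜_)
  open IsUFD ufd
  open DividesProperties R
  open IntegralDomainProperties R domain
  open PAdicValuation R domain p prime

  ¬unit-* : ∀ {x} y → ¬ IsUnit R x → ¬ IsUnit R (x * y)
  ¬unit-* {x} y x-nonunit (u , xyu≈1) = x-nonunit (y * u , trans (sym (*-assoc x y u)) xyu≈1)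

  ¬unit⇒factors-nonempty : ∀ {y} xs → ¬ IsUnit R y → prodL R xs ≈ y → 1 ℕ.≤ length xs
  ¬unit⇒factors-nonempty []      y-nonunit 1≈y = contradiction (1# , trans (*-identityʳ _) (sym 1≈y)) y-nonunit
  ¬unit⇒factors-nonempty (_ ∷ _) _         _   = ℕ.s≤s ℕ.z≤n

  prodL-replicate-++ : ∀ L ys → prodL R (replicate L p ++ ys) ≈ p ^ L * prodL R ys
  prodL-replicate-++ zero    ys = sym (*-identityˡ _)
  prodL-replicate-++ (suc L) ys =
    trans (*-congˡ (prodL-replicate-++ L ys)) (sym (*-assoc p (p ^ L) (prodL R ys)))

  -- If L is the length of a factorisation of p x, then x = k p^L would give the longer
  -- factorisation p^L · (k p) of p x.  (Factoring p x and k p rather than x and k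
  -- avoids units, which have the empty factorisation.)
  ^-∤-bound : ∀ {x} → ¬ (x ≈ 0#) → ∃ λ L → ¬ (p ^ L ∣ x)
  ^-∤-bound {x} x≉0 with factor-exists (p * x) (*-≉0 (proj₁ prime) x≉0) (¬unit-* x (proj₁ (proj₂ prime)))
  ... | xs , xs-irreducible , xs≈px = length xs , pᴸ∤x
    where
    L = length xs
    pᴸ∤x : ¬ (p ^ L ∣ x)
    pᴸ∤x (k , x≈kpᴸ) = too-long (factor-exists (k * p) (*-≉0 k≉0 (proj₁ prime)) kp-nonunit)
      where
      k≉0 : ¬ (k ≈ 0#)
      k≉0 k≈0 = x≉0 (trans x≈kpᴸ (trans (*-congʳ k≈0) (zeroˡ _)))
      kp-nonunit : ¬ IsUnit R (k * p)
      kp-nonunit (w , kpw≈1) = ¬unit-* k (proj₁ (proj₂ prime)) (w , trans (*-congʳ (*-comm p k)) kpw≈1)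
      too-long : ¬ ∃ λ zs → All (IsIrreducibleElt R) zs × prodL R zs ≈ k * p
      too-long (zs , zs-irreducible , zs≈kp) =
        ℕ.<-irrefl (≡.trans lengths-equal (List.length-++ (replicate L p)))
          (≡.subst (λ r → L ℕ.< r ℕ.+ length zs) (≡.sym (List.length-replicate L))
            (ℕ.m<m+n L (¬unit⇒factors-nonempty zs kp-nonunit zs≈kp)))
        where
        lengths-equal : length xs ≡ length (replicate L p ++ zs)
        lengths-equal = proj₁ (factor-unique xs (replicate L p ++ zs) xs-irreducible
          (All.++⁺ (All.replicate⁺ L (prime⇒irreducible prime)) zs-irreducible) (begin
            prodL R xs                       ≈⟨ xs≈px ⟩
            p * x                            ≈⟨ *-congˡ x≈kpᴸ ⟩
            p * (k * p ^ L)                  ≈⟨ solve 3 (λ p k q → p ⊕ (k ⊕ q) ⊜ q ⊕ (k ⊕ p)) refl p k (p ^ L) ⟩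
            p ^ L * (k * p)                  ≈⟨ *-congˡ zs≈kp ⟨
            p ^ L * prodL R zs               ≈⟨ prodL-replicate-++ L zs ⟨
            prodL R (replicate L p ++ zs)    ∎))

  ν-exists-below : ∀ {x} L → ¬ (p ^ L ∣ x) → DoubleNegation (∃ λ v → ν[ x ]≡ v)
  ν-exists-below {x} zero    p⁰∤x   = contradiction (x , sym (*-identityʳ x)) p⁰∤x
  ν-exists-below {x} (suc L) pᴸ⁺¹∤x = ¬¬-excluded-middle >>= λ where
    (yes pᴸ∣x) → pure (L , valuation pᴸ∣x pᴸ⁺¹∤x)
    (no pᴸ∤x)  → ν-exists-below L pᴸ∤x

  ν-exists : ∀ {x} → ¬ (x ≈ 0#) → DoubleNegation (∃ λ v → ν[ x ]≡ v)
  ν-exists x≉0 with ^-∤-bound x≉0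
  ... | L , pᴸ∤x = ν-exists-below L pᴸ∤x

  -- Excluded middle for each of the finitely many nonzero coefficients; the goal is ⊥.
  valued : ∀ {F} → IsDirichletPoly R F → DoubleNegation (Valued F)
  valued (N , vanishes) = ¬¬-∀-bounded N (λ i N<i → inj₁ (vanishes i N<i)) λ j k → ¬¬-excluded-middle λ where
    (yes Fj≈0) → k (inj₁ Fj≈0)
    (no  Fj≉0) → ν-exists Fj≉0 (k ∘ inj₂)

-- Dirichlet products

∣⇒quotient>0 : ∀ {d i} .{{_ : NonZero d}} → d ℕ.∣ i → 0 ℕ.< i → 0 ℕ.< i / d
∣⇒quotient>0 {d} d∣i 0<i = ℕ.n≢0⇒n>0 λ i/d≡0 → ℕ.<⇒≢ 0<i
  (≡.trans (≡.sym (ℕ.*-zeroʳ d)) (≡.trans (≡.cong (d ℕ.*_) (≡.sym i/d≡0)) (m*[n/m]≡n d∣i)))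

module DirichletProduct {c ℓ : Level} (K : CommutativeRing c ℓ) where
  open CommutativeRing K
  open import Relation.Binary.Reasoning.Setoid setoid
  open CommutativeMonoidSolver *-commutativeMonoid using (solve; _⊕_; _⊜_)

  module _ {q : Level} (Q : Carrier → Set q) (Q-resp : ∀ {x y} → x ≈ y → Q x → Q y)
           (Q-0 : Q 0#) (Q-+ : ∀ {x y} → Q x → Q y → Q (x + y)) where

    dsum-closed : ∀ g h i t → (∀ j l → j ℕ.* l ≡ i → j ℕ.≤ t → Q (g j * h l)) → Q (dsum K g h i t)
    dsum-closed g h i zero    _     = Q-0
    dsum-closed g h i (suc t) terms with suc t ∣? i
    ... | yes t+1∣i = Q-+ (dsum-closed g h i t λ j l jl≡i j≤t → terms j l jl≡i (ℕ.m≤n⇒m≤1+n j≤t))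
                          (terms (suc t) (i / suc t) (m*[n/m]≡n t+1∣i) ℕ.≤-refl)
    ... | no  _     = dsum-closed g h i t λ j l jl≡i j≤t → terms j l jl≡i (ℕ.m≤n⇒m≤1+n j≤t)

    dsum-split : ∀ g h j₀ l₀ t → j₀ ℕ.≤ t → .{{NonZero j₀}} →
                 (∀ j l → j ℕ.* l ≡ j₀ ℕ.* l₀ → j ≢ j₀ → Q (g j * h l)) →
                 ∃ λ r → Q r × dsum K g h (j₀ ℕ.* l₀) t ≈ g j₀ * h l₀ + r
    dsum-split g h zero l₀ zero z≤n {{()}} _
    dsum-split g h j₀ l₀ (suc t) j₀≤1+t others with suc t ∣? (j₀ ℕ.* l₀) | suc t ℕ.≟ j₀
    ... | yes t+1∣i | yes ≡.refl =
          dsum K g h (j₀ ℕ.* l₀) t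
        , dsum-closed g h _ t (λ j l jl≡i j≤t → others j l jl≡i λ { ≡.refl → ℕ.<-irrefl ≡.refl j≤t })
        , trans (+-comm _ _) (+-congʳ (*-congˡ (reflexive (≡.cong h quotient≡l₀))))
      where
      quotient≡l₀ : j₀ ℕ.* l₀ / j₀ ≡ l₀
      quotient≡l₀ = ℕ.*-cancelˡ-≡ _ l₀ j₀ (m*[n/m]≡n t+1∣i)
    ... | no t+1∤i | yes ≡.refl = contradiction (ℕ.m∣m*n l₀) t+1∤i
    ... | yes t+1∣i | no t+1≢j₀ with dsum-split g h j₀ l₀ t (ℕ.≤-pred (ℕ.≤∧≢⇒< j₀≤1+t (≡.≢-sym t+1≢j₀))) others
    ...   | r , Qr , sum≈ = r + g (suc t) * h (j₀ ℕ.* l₀ / suc t)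
                          , Q-+ Qr (others (suc t) _ (m*[n/m]≡n t+1∣i) t+1≢j₀)
                          , trans (+-congʳ sum≈) (+-assoc _ _ _)
    dsum-split g h j₀ l₀ (suc t) j₀≤1+t others | no _ | no t+1≢j₀ =
      dsum-split g h j₀ l₀ t (ℕ.≤-pred (ℕ.≤∧≢⇒< j₀≤1+t (≡.≢-sym t+1≢j₀))) others

    dmul-closed : ∀ g h k → (∀ j l → j ℕ.* l ≡ k → Q (g j * h l)) → Q (dmul K g h k)
    dmul-closed g h k terms = dsum-closed g h k k λ j l jl≡k _ → terms j l jl≡k

    dmul-split : ∀ g h j₀ l₀ .{{_ : NonZero j₀}} .{{_ : NonZero l₀}} →
                 (∀ j l → j ℕ.* l ≡ j₀ ℕ.* l₀ → j ≢ j₀ → Q (g j * h l)) →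
                 ∃ λ r → Q r × dmul K g h (j₀ ℕ.* l₀) ≈ g j₀ * h l₀ + r
    dmul-split g h j₀ l₀ = dsum-split g h j₀ l₀ (j₀ ℕ.* l₀) (ℕ.m≤m*n j₀ l₀)

  dsum-cong : ∀ {g g′ h h′} i t → 0 ℕ.< i → (∀ j → 0 ℕ.< j → g j ≈ g′ j) → (∀ j → 0 ℕ.< j → h j ≈ h′ j) →
              dsum K g h i t ≈ dsum K g′ h′ i t
  dsum-cong i zero    _   _   _   = refl
  dsum-cong i (suc t) 0<i g≈g′ h≈h′ with suc t ∣? i
  ... | yes t+1∣i = +-cong (dsum-cong i t 0<i g≈g′ h≈h′) (*-cong (g≈g′ (suc t) (s≤s z≤n)) (h≈h′ _ (∣⇒quotient>0 t+1∣i 0<i)))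
  ... | no  _     = dsum-cong i t 0<i g≈g′ h≈h′

  dsum-scale : ∀ g h s u i t → dsum K (λ j → g j * s) (λ j → h j * u) i t ≈ dsum K g h i t * (s * u)
  dsum-scale g h s u i zero    = sym (zeroˡ _)
  dsum-scale g h s u i (suc t) with suc t ∣? i
  ... | yes _ = begin
    dsum K (λ j → g j * s) (λ j → h j * u) i t + (g (suc t) * s) * (h (i / suc t) * u)
      ≈⟨ +-cong (dsum-scale g h s u i t) (solve 4 (λ x s y u → (x ⊕ s) ⊕ (y ⊕ u) ⊜ (x ⊕ y) ⊕ (s ⊕ u)) refl _ _ _ _) ⟩
    dsum K g h i t * (s * u) + (g (suc t) * h (i / suc t)) * (s * u)  ≈⟨ distribʳ _ _ _ ⟨
    (dsum K g h i t + g (suc t) * h (i / suc t)) * (s * u)             ∎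
  ... | no  _ = dsum-scale g h s u i t

module DirichletProductHomomorphism {c ℓ c′ ℓ′ : Level} (R : CommutativeRing c ℓ) (K : CommutativeRing c′ ℓ′)
  (φ : CommutativeRing.Carrier R → CommutativeRing.Carrier K)
  (homo : RingMorphisms.IsRingHomomorphism (CommutativeRing.rawRing R) (CommutativeRing.rawRing K) φ) where
  private module K = CommutativeRing K
  open RingMorphisms.IsRingHomomorphism homo

  dsum-homo : ∀ g h i t → φ (dsum R g h i t) K.≈ dsum K (λ j → φ (g j)) (λ j → φ (h j)) i t
  dsum-homo g h i zero    = 0#-homo
  dsum-homo g h i (suc t) with suc t ∣? i
  ... | yes _ = K.trans (+-homo _ _) (K.+-cong (dsum-homo g h i t) (*-homo _ _))
  ... | no  _ = dsum-homo g h i t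

-- dmul never looks at index 0; fixing G 0 and H 0 to be 0 keeps the supports positive.
record ScaledFactorisation {c ℓ : Level} (R : CommutativeRing c ℓ) (a : ℕ → CommutativeRing.Carrier R) : Set (c ⊔ ℓ) where
  open CommutativeRing R
  field
    B            : Carrier
    B≉0          : ¬ (B ≈ 0#)
    G H          : ℕ → Carrier
    G0≈0         : G 0 ≈ 0#
    H0≈0         : H 0 ≈ 0#
    G-poly       : IsDirichletPoly R G
    H-poly       : IsDirichletPoly R H
    G-nonconstant : IsNonconstant R G
    H-nonconstant : IsNonconstant R H
    Ba≈G*H       : ∀ i → 1 ℕ.≤ i → B * a i ≈ dmul R G H i

module ClearingDenominators {c ℓ c′ ℓ′ : Level} (R : CommutativeRing c ℓ) (dom : IsIntegralDomain R)
  (K : CommutativeRing c′ ℓ′) (ι : CommutativeRing.Carrier R → CommutativeRing.Carrier K)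
  (fractionField : IsFractionField R K ι) where
  private module R = CommutativeRing R
  open CommutativeRing K
  open IsFractionField fractionField
  open RingMorphisms.IsRingHomomorphism homo
  open import Relation.Binary.Reasoning.Setoid setoid
  open CommutativeMonoidSolver *-commutativeMonoid using (solve; _⊕_; _⊜_)
  open IntegralDomainProperties R dom using (*-≉0)
  open DirichletProduct K using (dsum-cong; dsum-scale)
  open DirichletProductHomomorphism R K ι homo using (dsum-homo)

  Clears : R.Carrier → Carrier → Set (c ⊔ ℓ′)
  Clears b x = ∃ λ r → x * ι b ≈ ι r

  clears-*ʳ : ∀ {b x} b′ → Clears b x → Clears (b R.* b′) x
  clears-*ʳ {b} {x} b′ (r , xb≈r) = r R.* b′ , (begin
    x * ι (b R.* b′)    ≈⟨ *-congˡ (*-homo b b′) ⟩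
    x * (ι b * ι b′)    ≈⟨ *-assoc x _ _ ⟨
    (x * ι b) * ι b′    ≈⟨ *-congʳ xb≈r ⟩
    ι r * ι b′          ≈⟨ *-homo r b′ ⟨
    ι (r R.* b′)        ∎)

  clears-*ˡ : ∀ {b x} b′ → Clears b x → Clears (b′ R.* b) x
  clears-*ˡ {b} {x} b′ (r , xb≈r) = r R.* b′ , (begin
    x * ι (b′ R.* b)    ≈⟨ *-congˡ (*-homo b′ b) ⟩
    x * (ι b′ * ι b)    ≈⟨ solve 3 (λ x u v → x ⊕ (u ⊕ v) ⊜ (x ⊕ v) ⊕ u) refl x (ι b′) (ι b) ⟩
    (x * ι b) * ι b′    ≈⟨ *-congʳ xb≈r ⟩
    ι r * ι b′          ≈⟨ *-homo r b′ ⟨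
    ι (r R.* b′)        ∎)

  common-denominator-upto : ∀ (g : ℕ → Carrier) N →
    ∃ λ B → ¬ (B R.≈ R.0#) × (∀ i → i ℕ.≤ N → Clears B (g i))
  common-denominator-upto g zero with fractions (g 0)
  ... | r , b , b≉0 , gb≈r = b , b≉0 , λ { zero _ → r , gb≈r }
  common-denominator-upto g (suc N) with common-denominator-upto g N | fractions (g (suc N))
  ... | B , B≉0 , clears | r , b , b≉0 , gb≈r = B R.* b , *-≉0 B≉0 b≉0 , clears′
    where
    clears′ : ∀ i → i ℕ.≤ suc N → Clears (B R.* b) (g i)
    clears′ i i≤1+N with ℕ.m≤n⇒m<n∨m≡n i≤1+N
    ... | inj₁ i<1+N  = clears-*ʳ b (clears i (ℕ.≤-pred i<1+N))
    ... | inj₂ ≡.refl = clears-*ˡ B (r , gb≈r)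

  common-denominator : ∀ g → IsDirichletPoly K g → ∃ λ B → ¬ (B R.≈ R.0#) × (∀ i → Clears B (g i))
  common-denominator g (N , vanishes) with common-denominator-upto g N
  ... | B , B≉0 , clears = B , B≉0 , clears′
    where
    clears′ : ∀ i → Clears B (g i)
    clears′ i with i ℕ.≤? N
    ... | yes i≤N = clears i i≤N
    ... | no  i≰N = R.0# , trans (*-congʳ (vanishes i (ℕ.≰⇒> i≰N))) (trans (zeroˡ _) (sym 0#-homo))

  ι≈0⇒≈0 : ∀ {x} → ι x ≈ 0# → x R.≈ R.0#
  ι≈0⇒≈0 {x} ιx≈0 = injective x R.0# (trans ιx≈0 (sym 0#-homo))

  *ι≈0⇒≈0 : ∀ {x b} → ¬ (b R.≈ R.0#) → x * ι b ≈ 0# → x ≈ 0#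
  *ι≈0⇒≈0 {x} {b} b≉0 xb≈0 with inverses b b≉0
  ... | y , by≈1 = begin
    x              ≈⟨ *-identityʳ x ⟨
    x * 1#         ≈⟨ *-congˡ by≈1 ⟨
    x * (ι b * y)  ≈⟨ *-assoc x _ _ ⟨
    (x * ι b) * y  ≈⟨ *-congʳ xb≈0 ⟩
    0# * y         ≈⟨ zeroˡ y ⟩
    0#             ∎

  module Numerators (g : ℕ → Carrier) (B : R.Carrier) (clears : ∀ i → Clears B (g i)) where
    numerator : ℕ → R.Carrier
    numerator zero    = R.0#
    numerator (suc i) = proj₁ (clears (suc i))

    ι-numerator : ∀ j → 0 ℕ.< j → ι (numerator j) ≈ g j * ι B
    ι-numerator (suc j) _ = sym (proj₂ (clears (suc j)))

    numerator-poly : IsDirichletPoly K g → IsDirichletPoly R numerator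
    numerator-poly (N , vanishes) = N , λ where
      zero    _   → R.refl
      (suc i) N<i → ι≈0⇒≈0 (trans (ι-numerator (suc i) (s≤s z≤n)) (trans (*-congʳ (vanishes (suc i) N<i)) (zeroˡ _)))

    numerator-nonconstant : ¬ (B R.≈ R.0#) → IsNonconstant K g → IsNonconstant R numerator
    numerator-nonconstant B≉0 (i , 2≤i , gi≉0) = i , 2≤i , λ numerator≈0 → gi≉0 (*ι≈0⇒≈0 B≉0 (begin
      g i * ι B        ≈⟨ ι-numerator i (ℕ.<-trans (s≤s z≤n) 2≤i) ⟨
      ι (numerator i)  ≈⟨ ⟦⟧-cong numerator≈0 ⟩
      ι R.0#           ≈⟨ 0#-homo ⟩
      0#               ∎))

  clear-denominators : ∀ a g h → IsDirichletPoly K g → IsDirichletPoly K h →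
    IsNonconstant K g → IsNonconstant K h → (∀ i → 1 ℕ.≤ i → ι (a i) ≈ dmul K g h i) →
    ScaledFactorisation R a
  clear-denominators a g h g-poly h-poly g-nonconstant h-nonconstant ιa≈g*h
    with common-denominator g g-poly | common-denominator h h-poly
  ... | Bg , Bg≉0 , g-clears | Bh , Bh≉0 , h-clears = record
    { B = Bg R.* Bh ; B≉0 = *-≉0 Bg≉0 Bh≉0 ; G = G.numerator ; H = H.numerator
    ; G0≈0 = R.refl ; H0≈0 = R.refl
    ; G-poly = G.numerator-poly g-poly ; H-poly = H.numerator-poly h-poly
    ; G-nonconstant = G.numerator-nonconstant Bg≉0 g-nonconstant
    ; H-nonconstant = H.numerator-nonconstant Bh≉0 h-nonconstant
    ; Ba≈G*H = λ i 1≤i → injective _ _ (begin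
        ι ((Bg R.* Bh) R.* a i)         ≈⟨ *-homo _ _ ⟩
        ι (Bg R.* Bh) * ι (a i)         ≈⟨ *-cong (*-homo Bg Bh) (ιa≈g*h i 1≤i) ⟩
        (ι Bg * ι Bh) * dmul K g h i    ≈⟨ *-comm _ _ ⟩
        dmul K g h i * (ι Bg * ι Bh)    ≈⟨ dsum-scale g h (ι Bg) (ι Bh) i i ⟨
        dsum K (λ j → g j * ι Bg) (λ j → h j * ι Bh) i i
          ≈⟨ dsum-cong i i 1≤i G.ι-numerator H.ι-numerator ⟨
        dmul K (λ j → ι (G.numerator j)) (λ j → ι (H.numerator j)) i  ≈⟨ dsum-homo G.numerator H.numerator i i ⟨
        ι (dmul R G.numerator H.numerator i)  ∎) }
    where
    module G = Numerators g Bg g-clears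
    module H = Numerators h Bh h-clears

-- Fractions and the weight of a term

module Fraction where
  open import Data.Nat using (_*_; _≤_; _<_)
  open CommutativeMonoidSolver ℕ.*-1-commutativeMonoid using (solve; _⊕_; _⊜_)
  open ℕ.≤-Reasoning

  -- (a , b) stands for a / b; the orders compare cross products, as for ℚᵘ, and are
  -- records so that the compared fractions can be inferred.
  Fraction : Set
  Fraction = ℕ × ℕ

  infix 4 _≤ᶠ_ _<ᶠ_ _≃ᶠ_
  infixl 7 _·_

  record _≤ᶠ_ (x y : Fraction) : Set where
    constructor *≤*
    field cross : proj₁ x * proj₂ y ≤ proj₁ y * proj₂ x

  record _<ᶠ_ (x y : Fraction) : Set where
    constructor *<*
    field cross : proj₁ x * proj₂ y < proj₁ y * proj₂ x

  _≃ᶠ_ : Fraction → Fraction → Set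
  x ≃ᶠ y = x ≤ᶠ y × y ≤ᶠ x

  _·_ : Fraction → Fraction → Fraction
  (a , b) · (c , d) = a * c , b * d

  Positive : Fraction → Set
  Positive (a , b) = 0 < a × 0 < b

  ·-positive : ∀ {x y} → Positive x → Positive y → Positive (x · y)
  ·-positive (0<a , 0<b) (0<c , 0<d) = ℕ.*-mono-< 0<a 0<c , ℕ.*-mono-< 0<b 0<d

  _≤ᶠ?_ : ∀ x y → Dec (x ≤ᶠ y)
  (a , b) ≤ᶠ? (c , d) = map′ *≤* _≤ᶠ_.cross (a * d ℕ.≤? c * b)

  ≤ᶠ-refl : ∀ {x} → x ≤ᶠ x
  ≤ᶠ-refl = *≤* ℕ.≤-refl

  <ᶠ⇒≤ᶠ : ∀ {x y} → x <ᶠ y → x ≤ᶠ y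
  <ᶠ⇒≤ᶠ (*<* ad<cb) = *≤* (ℕ.<⇒≤ ad<cb)

  ≰ᶠ⇒>ᶠ : ∀ {x y} → ¬ (x ≤ᶠ y) → y <ᶠ x
  ≰ᶠ⇒>ᶠ x≰y = *<* (ℕ.≰⇒> (λ ad≤cb → x≰y (*≤* ad≤cb)))

  <ᶠ⇒≱ᶠ : ∀ {x y} → x <ᶠ y → ¬ (y ≤ᶠ x)
  <ᶠ⇒≱ᶠ (*<* ad<cb) (*≤* cb≤ad) = ℕ.<⇒≱ ad<cb cb≤ad

  private
    middle-four : ∀ a d c f → (a * f) * (c * d) ≡ (a * d) * (c * f)
    middle-four a d c f = solve 4 (λ a d c f → (a ⊕ f) ⊕ (c ⊕ d) ⊜ (a ⊕ d) ⊕ (c ⊕ f)) ≡.refl a d c f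

    outer-four : ∀ c b e d → (c * b) * (e * d) ≡ (e * b) * (c * d)
    outer-four c b e d = solve 4 (λ c b e d → (c ⊕ b) ⊕ (e ⊕ d) ⊜ (e ⊕ b) ⊕ (c ⊕ d)) ≡.refl c b e d

  ≤ᶠ-trans : ∀ {x y z} → Positive y → x ≤ᶠ y → y ≤ᶠ z → x ≤ᶠ z
  ≤ᶠ-trans {a , b} {c , d} {e , f} (0<c , 0<d) (*≤* ad≤cb) (*≤* cf≤ed) = *≤* (
    ℕ.*-cancelʳ-≤ (a * f) (e * b) (c * d) {{ℕ.>-nonZero (ℕ.*-mono-< 0<c 0<d)}} (begin
      (a * f) * (c * d)  ≡⟨ middle-four a d c f ⟩
      (a * d) * (c * f)  ≤⟨ ℕ.*-mono-≤ ad≤cb cf≤ed ⟩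
      (c * b) * (e * d)  ≡⟨ outer-four c b e d ⟩
      (e * b) * (c * d)  ∎))

  <ᶠ-≤ᶠ-trans : ∀ {x y z} → Positive y → Positive z → x <ᶠ y → y ≤ᶠ z → x <ᶠ z
  <ᶠ-≤ᶠ-trans {a , b} {c , d} {e , f} (0<c , 0<d) (_ , 0<f) (*<* ad<cb) (*≤* cf≤ed) = *<* (
    ℕ.*-cancelʳ-< (c * d) (a * f) (e * b) (begin-strict
      (a * f) * (c * d)  ≡⟨ middle-four a d c f ⟩
      (a * d) * (c * f)  <⟨ ℕ.*-monoˡ-< (c * f) {{ℕ.>-nonZero (ℕ.*-mono-< 0<c 0<f)}} ad<cb ⟩
      (c * b) * (c * f)  ≤⟨ ℕ.*-monoʳ-≤ (c * b) cf≤ed ⟩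
      (c * b) * (e * d)  ≡⟨ outer-four c b e d ⟩
      (e * b) * (c * d)  ∎))

  ≤ᶠ-<ᶠ-trans : ∀ {x y z} → Positive x → Positive y → x ≤ᶠ y → y <ᶠ z → x <ᶠ z
  ≤ᶠ-<ᶠ-trans {a , b} {c , d} {e , f} (_ , 0<b) (0<c , 0<d) (*≤* ad≤cb) (*<* cf<ed) = *<* (
    ℕ.*-cancelʳ-< (c * d) (a * f) (e * b) (begin-strict
      (a * f) * (c * d)  ≡⟨ middle-four a d c f ⟩
      (a * d) * (c * f)  ≤⟨ ℕ.*-monoˡ-≤ (c * f) ad≤cb ⟩
      (c * b) * (c * f)  <⟨ ℕ.*-monoʳ-< (c * b) {{ℕ.>-nonZero (ℕ.*-mono-< 0<c 0<b)}} cf<ed ⟩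
      (c * b) * (e * d)  ≡⟨ outer-four c b e d ⟩
      (e * b) * (c * d)  ∎))

  private
    interchange : ∀ a b c d → (a * b) * (c * d) ≡ (a * c) * (b * d)
    interchange a b c d = solve 4 (λ a b c d → (a ⊕ b) ⊕ (c ⊕ d) ⊜ (a ⊕ c) ⊕ (b ⊕ d)) ≡.refl a b c d

  ·-mono-≤ᶠ : ∀ {x y u v} → x ≤ᶠ y → u ≤ᶠ v → x · u ≤ᶠ y · v
  ·-mono-≤ᶠ {a , b} {c , d} {a′ , b′} {c′ , d′} (*≤* ad≤cb) (*≤* ad≤cb′) = *≤* (begin
    (a * a′) * (d * d′)  ≡⟨ interchange a a′ d d′ ⟩
    (a * d) * (a′ * d′)  ≤⟨ ℕ.*-mono-≤ ad≤cb ad≤cb′ ⟩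
    (c * b) * (c′ * b′)  ≡⟨ interchange c b c′ b′ ⟩
    (c * c′) * (b * b′)  ∎)

  ·-mono-<ᶠ-≤ᶠ : ∀ {x y u v} → Positive u → Positive v → x <ᶠ y → u ≤ᶠ v → x · u <ᶠ y · v
  ·-mono-<ᶠ-≤ᶠ {a , b} {c , d} {a′ , b′} {c′ , d′} (0<a′ , _) (_ , 0<d′) (*<* ad<cb) (*≤* ad≤cb′) = *<* (begin-strict
    (a * a′) * (d * d′)  ≡⟨ interchange a a′ d d′ ⟩
    (a * d) * (a′ * d′)  <⟨ ℕ.*-monoˡ-< (a′ * d′) {{ℕ.>-nonZero (ℕ.*-mono-< 0<a′ 0<d′)}} ad<cb ⟩
    (c * b) * (a′ * d′)  ≤⟨ ℕ.*-monoʳ-≤ (c * b) ad≤cb′ ⟩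
    (c * b) * (c′ * b′)  ≡⟨ interchange c b c′ b′ ⟩
    (c * c′) * (b * b′)  ∎)

  ·-comm : ∀ x y → x · y ≡ y · x
  ·-comm (a , b) (c , d) = ≡.cong₂ _,_ (ℕ.*-comm a c) (ℕ.*-comm b d)

  ·-mono-≤ᶠ-<ᶠ : ∀ {x y u v} → Positive x → Positive y → x ≤ᶠ y → u <ᶠ v → x · u <ᶠ y · v
  ·-mono-≤ᶠ-<ᶠ {x} {y} {u} {v} x>0 y>0 x≤y u<v =
    ≡.subst₂ _<ᶠ_ (·-comm u x) (·-comm v y) (·-mono-<ᶠ-≤ᶠ x>0 y>0 u<v x≤y)

  ·-≤ᶠ-cancel : ∀ {x x′ y y′} → Positive x → Positive x′ → Positive y → Positive y′ →
                x′ ≤ᶠ x → y′ ≤ᶠ y → x · y ≤ᶠ x′ · y′ → x ≤ᶠ x′ × y ≤ᶠ y′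
  ·-≤ᶠ-cancel {x} {x′} {y} {y′} x>0 x′>0 y>0 y′>0 x′≤x y′≤y xy≤x′y′ = x≤x′ , y≤y′
    where
    x≤x′ : x ≤ᶠ x′
    x≤x′ with x ≤ᶠ? x′
    ... | yes x≤x′ = x≤x′
    ... | no  x≰x′ = contradiction xy≤x′y′ (<ᶠ⇒≱ᶠ (·-mono-<ᶠ-≤ᶠ y′>0 y>0 (≰ᶠ⇒>ᶠ x≰x′) y′≤y))
    y≤y′ : y ≤ᶠ y′
    y≤y′ with y ≤ᶠ? y′
    ... | yes y≤y′ = y≤y′
    ... | no  y≰y′ = contradiction xy≤x′y′ (<ᶠ⇒≱ᶠ (·-mono-≤ᶠ-<ᶠ x′>0 x>0 x′≤x (≰ᶠ⇒>ᶠ y≰y′)))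

module NatPowers where
  open import Data.Nat using (_+_; _*_; _^_; _<_)

  ^-positive : ∀ {a} k → 0 < a → 0 < a ^ k
  ^-positive {a} k 0<a = ℕ.m^n>0 a {{ℕ.>-nonZero 0<a}} k

  ^-cross-< : ∀ {a b u w} → 0 < a → a < b → u < w → b ^ u * a ^ w < a ^ u * b ^ w
  ^-cross-< {a} {b} {u} {w} 0<a a<b u<w with ℕ.m≤n⇒∃[o]m+o≡n u<w
  ... | s , ≡.refl = begin-strict
    b ^ u * a ^ (suc u + s)        ≡⟨ ≡.cong (λ e → b ^ u * a ^ e) (ℕ.+-suc u s) ⟨
    b ^ u * a ^ (u + suc s)        ≡⟨ ≡.cong (b ^ u *_) (ℕ.^-distribˡ-+-* a u (suc s)) ⟩
    b ^ u * (a ^ u * a ^ suc s)    ≡⟨ ℕ.*-assoc (b ^ u) _ _ ⟨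
    b ^ u * a ^ u * a ^ suc s      <⟨ ℕ.*-monoʳ-< (b ^ u * a ^ u) {{ℕ.>-nonZero b^ua^u>0}} (ℕ.^-monoˡ-< (suc s) a<b) ⟩
    b ^ u * a ^ u * b ^ suc s      ≡⟨ ≡.cong (_* b ^ suc s) (ℕ.*-comm (b ^ u) (a ^ u)) ⟩
    a ^ u * b ^ u * b ^ suc s      ≡⟨ ℕ.*-assoc (a ^ u) _ _ ⟩
    a ^ u * (b ^ u * b ^ suc s)    ≡⟨ ≡.cong (a ^ u *_) (ℕ.^-distribˡ-+-* b u (suc s)) ⟨
    a ^ u * b ^ (u + suc s)        ≡⟨ ≡.cong (λ e → a ^ u * b ^ e) (ℕ.+-suc u s) ⟩
    a ^ u * b ^ (suc u + s)        ∎
    where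
    open ℕ.≤-Reasoning
    b^ua^u>0 : 0 < b ^ u * a ^ u
    b^ua^u>0 = ℕ.*-mono-< (^-positive u (ℕ.<-trans 0<a a<b)) (^-positive u 0<a)

  ^-distribʳ-* : ∀ a b k → (a * b) ^ k ≡ a ^ k * b ^ k
  ^-distribʳ-* a b zero    = ≡.refl
  ^-distribʳ-* a b (suc k) = ≡.trans (≡.cong ((a * b) *_) (^-distribʳ-* a b k)) (interchange a b (a ^ k) (b ^ k))
    where
    open CommutativeMonoidSolver ℕ.*-1-commutativeMonoid using (solve; _⊕_; _⊜_)
    interchange : ∀ a b c d → (a * b) * (c * d) ≡ (a * c) * (b * d)
    interchange = solve 4 (λ a b c d → (a ⊕ b) ⊕ (c ⊕ d) ⊜ (a ⊕ c) ⊕ (b ⊕ d)) ≡.refl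

module RationalRepresentation where
  open import Data.Nat using (_+_; _*_; _^_; _<_)
  open import Data.Integer as ℤ using (+_; -[1+_]; _⊖_)
  import Data.Integer.Properties as ℤ
  open import Data.Rational as ℚ using (ℚ; toℚᵘ)
  import Data.Rational.Properties as ℚ
  open import Data.Rational.Unnormalised as ℚᵘ using (mkℚᵘ; *≡*)
  import Data.Rational.Unnormalised.Properties as ℚᵘ
  open Fraction
  open NatPowers using (^-positive)
  open CommutativeMonoidSolver ℕ.*-1-commutativeMonoid using (solve; _⊕_; _⊜_)

  Represents : ℚ → Fraction → Set
  Represents x (a , b) = ∃ λ b-1 → b ≡ suc b-1 × toℚᵘ x ℚᵘ.≃ mkℚᵘ (+ a) b-1

  _^ᶠ_ : Fraction → ℕ → Fraction
  (a , b) ^ᶠ k = a ^ k , b ^ k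

  represents-frac : ∀ a b → 0 < b → Represents (frac a b) (a , b)
  represents-frac a (suc b-1) _ = b-1 , ≡.refl , ℚ.toℚᵘ-fromℚᵘ (mkℚᵘ (+ a) b-1)

  represents-* : ∀ {x y f g} → Represents x f → Represents y g → Represents (x ℚ.* y) (f · g)
  represents-* {x} {y} {a , _} {c , _} (b-1 , ≡.refl , x≃a/b) (d-1 , ≡.refl , y≃c/d) =
    _ , ≡.refl , ℚᵘ.≃-trans (ℚ.toℚᵘ-homo-* x y)
      (ℚᵘ.≃-trans (ℚᵘ.*-cong x≃a/b y≃c/d) (*≡* (≡.cong (ℤ._* (+ suc (d-1 + b-1 * suc d-1))) (≡.sym (ℤ.pos-* a c)))))

  represents-qpow : ∀ {x f} → Represents x f → ∀ k → Represents (qpow x k) (f ^ᶠ k)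
  represents-qpow x≈f zero    = 0 , ≡.refl , ℚᵘ.≃-refl
  represents-qpow x≈f (suc k) = represents-* x≈f (represents-qpow x≈f k)

  represents-cross : ∀ {x a b c d} → Represents x (a , b) → a * d ≡ c * b → 0 < d → Represents x (c , d)
  represents-cross {a = a} {c = c} {d = suc d-1} (b-1 , ≡.refl , x≃a/b) ad≡cb _ =
    d-1 , ≡.refl , ℚᵘ.≃-trans x≃a/b (*≡* (≡.trans (≡.sym (ℤ.pos-* a (suc d-1)))
                                          (≡.trans (≡.cong +_ ad≡cb) (ℤ.pos-* c (suc b-1)))))

  represents-< : ∀ {x y f g} → Represents x f → Represents y g → x ℚ.< y → f <ᶠ g
  represents-< {x} {y} {a , _} {c , _} (b-1 , ≡.refl , x≃a/b) (d-1 , ≡.refl , y≃c/d) x<y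
    with ℚᵘ.<-respʳ-≃ y≃c/d (ℚᵘ.<-respˡ-≃ x≃a/b (ℚ.toℚᵘ-mono-< x<y))
  ... | ℚᵘ.*<* ad<cb = *<* (ℤ.drop‿+<+ (≡.subst₂ ℤ._<_ (≡.sym (ℤ.pos-* a (suc d-1))) (≡.sym (ℤ.pos-* c (suc b-1))) ad<cb))

  represents-zpow : ∀ {a b} u w → 0 < a → 0 < b → Represents (zpow a b (u ⊖ w)) (a ^ u * b ^ w , b ^ u * a ^ w)
  represents-zpow {a} {b} u w 0<a 0<b with w ℕ.≤? u
  ... | yes w≤u with ℕ.m≤n⇒∃[o]m+o≡n w≤u
  ...   | t , ≡.refl = ≡.subst (λ e → Represents (zpow a b e) (a ^ (w + t) * b ^ w , b ^ (w + t) * a ^ w)) (≡.sym u⊖w≡t)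
          (represents-cross (represents-qpow (represents-frac a b 0<b) t) cross (ℕ.*-mono-< (^-positive u 0<b) (^-positive w 0<a)))
    where
    u⊖w≡t : (w + t) ⊖ w ≡ + t
    u⊖w≡t = ≡.trans (ℤ.⊖-≥ w≤u) (≡.cong +_ (ℕ.m+n∸m≡n w t))
    cross : a ^ t * (b ^ (w + t) * a ^ w) ≡ (a ^ (w + t) * b ^ w) * b ^ t
    cross rewrite ℕ.^-distribˡ-+-* a w t | ℕ.^-distribˡ-+-* b w t =
      solve 4 (λ x y z v → x ⊕ ((y ⊕ z) ⊕ v) ⊜ ((v ⊕ x) ⊕ y) ⊕ z) ≡.refl (a ^ t) (b ^ w) (b ^ t) (a ^ w)
  represents-zpow {a} {b} u w 0<a 0<b | no w≰u with ℕ.m≤n⇒∃[o]m+o≡n (ℕ.<⇒≤ (ℕ.≰⇒> w≰u))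
  ...   | zero  , ≡.refl = contradiction (ℕ.≤-reflexive (ℕ.+-identityʳ u)) w≰u
  ...   | suc s , ≡.refl = ≡.subst (λ e → Represents (zpow a b e) (a ^ u * b ^ (u + suc s) , b ^ u * a ^ (u + suc s))) (≡.sym u⊖w≡-s)
          (represents-cross (represents-qpow (represents-frac b a 0<a) (suc s)) cross (ℕ.*-mono-< (^-positive u 0<b) (^-positive (u + suc s) 0<a)))
    where
    u⊖w≡-s : u ⊖ (u + suc s) ≡ -[1+ s ]
    u⊖w≡-s = ≡.trans (ℤ.⊖-< (ℕ.≰⇒> w≰u)) (≡.cong (λ e → ℤ.- (+ e)) (ℕ.m+n∸m≡n u (suc s)))
    cross : b ^ suc s * (b ^ u * a ^ (u + suc s)) ≡ (a ^ u * b ^ (u + suc s)) * a ^ suc s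
    cross rewrite ℕ.^-distribˡ-+-* a u (suc s) | ℕ.^-distribˡ-+-* b u (suc s) =
      solve 4 (λ x y z v → x ⊕ (y ⊕ (z ⊕ v)) ⊜ (z ⊕ (y ⊕ x)) ⊕ v) ≡.refl (b ^ suc s) (b ^ u) (a ^ u) (a ^ suc s)

module Weight (m n vm vn : ℕ) (0<m : 0 ℕ.< m) (m≤n : m ℕ.≤ n) where
  open import Data.Nat using (_+_; _*_; _^_; _≤_; _<_)
  open NatPowers
  open Fraction
  open RationalRepresentation using (represents-zpow; represents-<)
  open CommutativeMonoidSolver ℕ.*-1-commutativeMonoid using (solve; _⊕_; _⊜_)

  -- weight i v = (n/m)^v · i^(vm - vn) is the exponential of the linear form
  -- v log(n/m) - (vn - vm) log i, which is constant on the line through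
  -- (log m , vm) and (log n , vn).
  weight : ℕ → ℕ → Fraction
  weight i v = (n ^ v , m ^ v) · (i ^ vm , i ^ vn)

  0<n : 0 < n
  0<n = ℕ.<-≤-trans 0<m m≤n

  nᵍ/mᵍ-positive : ∀ g → Positive (n ^ g , m ^ g)
  nᵍ/mᵍ-positive g = ^-positive g 0<n , ^-positive g 0<m

  weight-positive : ∀ {i} v → 0 < i → Positive (weight i v)
  weight-positive v 0<i = ·-positive (nᵍ/mᵍ-positive v) (^-positive vm 0<i , ^-positive vn 0<i)

  ·-interchange : ∀ x y u v → (x · y) · (u · v) ≡ (x · u) · (y · v)
  ·-interchange (a , b) (c , d) (e , f) (g , h) = ≡.cong₂ _,_ (interchange a c e g) (interchange b d f h)
    where
    interchange : ∀ a b c d → (a * b) * (c * d) ≡ (a * c) * (b * d)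
    interchange = solve 4 (λ a b c d → (a ⊕ b) ⊕ (c ⊕ d) ⊜ (a ⊕ c) ⊕ (b ⊕ d)) ≡.refl

  weight-* : ∀ i j v w → weight (i * j) (v + w) ≡ weight i v · weight j w
  weight-* i j v w = begin
    (n ^ (v + w) , m ^ (v + w)) · ((i * j) ^ vm , (i * j) ^ vn)
      ≡⟨ ≡.cong₂ _·_ (≡.cong₂ _,_ (ℕ.^-distribˡ-+-* n v w) (ℕ.^-distribˡ-+-* m v w))
                     (≡.cong₂ _,_ (^-distribʳ-* i j vm) (^-distribʳ-* i j vn)) ⟩
    ((n ^ v , m ^ v) · (n ^ w , m ^ w)) · ((i ^ vm , i ^ vn) · (j ^ vm , j ^ vn))
      ≡⟨ ·-interchange (n ^ v , m ^ v) _ _ _ ⟩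
    weight i v · weight j w  ∎
    where open ≡.≡-Reasoning

  weight-shift : ∀ i g v → weight i (g + v) ≡ (n ^ g , m ^ g) · weight i v
  weight-shift i g v = begin
    (n ^ (g + v) , m ^ (g + v)) · (i ^ vm , i ^ vn)
      ≡⟨ ≡.cong (_· (i ^ vm , i ^ vn)) (≡.cong₂ _,_ (ℕ.^-distribˡ-+-* n g v) (ℕ.^-distribˡ-+-* m g v)) ⟩
    ((n ^ g , m ^ g) · (n ^ v , m ^ v)) · (i ^ vm , i ^ vn)
      ≡⟨ ≡.cong₂ _,_ (ℕ.*-assoc (n ^ g) _ _) (ℕ.*-assoc (m ^ g) _ _) ⟩
    (n ^ g , m ^ g) · weight i v  ∎
    where open ≡.≡-Reasoning

  weight-shift-≤ᶠ : ∀ {i j v w} g → weight i v ≤ᶠ weight j w → weight i (g + v) ≤ᶠ weight j (g + w)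
  weight-shift-≤ᶠ {i} {j} {v} {w} g iv≤jw =
    ≡.subst₂ _≤ᶠ_ (≡.sym (weight-shift i g v)) (≡.sym (weight-shift j g w)) (·-mono-≤ᶠ {n ^ g , m ^ g} {n ^ g , m ^ g} ≤ᶠ-refl iv≤jw)

  weight-monoʳ : ∀ {i v w} → v ≤ w → weight i v ≤ᶠ weight i w
  weight-monoʳ {i} {v} v≤w with ℕ.m≤n⇒∃[o]m+o≡n v≤w
  ... | t , ≡.refl = ≡.subst₂ _≤ᶠ_ (≡.cong₂ _,_ (ℕ.*-identityˡ _) (ℕ.*-identityˡ _))
                                    (≡.trans (≡.sym (weight-shift i t v)) (≡.cong (weight i) (ℕ.+-comm t v)))
                                    (·-mono-≤ᶠ {1 , 1} {n ^ t , m ^ t} (*≤* mᵗ≤nᵗ) (≤ᶠ-refl {weight i v}))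
    where
    mᵗ≤nᵗ : 1 * m ^ t ≤ n ^ t * 1
    mᵗ≤nᵗ = ≡.subst₂ _≤_ (≡.sym (ℕ.*-identityˡ _)) (≡.sym (ℕ.*-identityʳ _)) (ℕ.^-monoˡ-≤ t m≤n)

  <ᶠ-same-index⇒< : ∀ {k V V′} → weight k V <ᶠ weight k V′ → V < V′
  <ᶠ-same-index⇒< {k} {V} {V′} kV<kV′ = ℕ.≰⇒> λ V′≤V → <ᶠ⇒≱ᶠ kV<kV′ (weight-monoʳ V′≤V)

  weight-index-< : ∀ {i I} v → vm < vn → 0 < i → i < I → weight I v <ᶠ weight i v
  weight-index-< {i} {I} v vm<vn 0<i i<I =
    ·-mono-≤ᶠ-<ᶠ {n ^ v , m ^ v} {n ^ v , m ^ v} (nᵍ/mᵍ-positive v) (nᵍ/mᵍ-positive v) ≤ᶠ-refl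
      (*<* (^-cross-< 0<i i<I vm<vn))

  weight-index-> : ∀ {i I} v → vn < vm → 0 < i → i < I → weight i v <ᶠ weight I v
  weight-index-> {i} {I} v vn<vm 0<i i<I =
    ·-mono-≤ᶠ-<ᶠ {n ^ v , m ^ v} {n ^ v , m ^ v} (nᵍ/mᵍ-positive v) (nᵍ/mᵍ-positive v) ≤ᶠ-refl
      (*<* (≡.subst₂ _<_ (ℕ.*-comm (I ^ vn) _) (ℕ.*-comm (i ^ vn) _) (^-cross-< 0<i i<I vn<vm)))

  weight-ends : weight m vm ≃ᶠ weight n vn
  weight-ends = *≤* (ℕ.≤-reflexive cross-equal) , *≤* (ℕ.≤-reflexive (≡.sym cross-equal))
    where
    cross-equal : (n ^ vm * m ^ vm) * (m ^ vn * n ^ vn) ≡ (n ^ vn * n ^ vm) * (m ^ vm * m ^ vn)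
    cross-equal = solve 4 (λ a b c d → (a ⊕ b) ⊕ (c ⊕ d) ⊜ (d ⊕ a) ⊕ (b ⊕ c)) ≡.refl (n ^ vm) (m ^ vm) (m ^ vn) (n ^ vn)

  exponent-increases : ∀ {i I α A} → vm < vn → 0 < i → i < I → weight i α ≤ᶠ weight I A → α < A
  exponent-increases {i} {I} {α} {A} vm<vn 0<i i<I iα≤IA = ℕ.≰⇒> λ A≤α →
    <ᶠ⇒≱ᶠ (<ᶠ-≤ᶠ-trans (weight-positive A 0<i) (weight-positive α 0<i) (weight-index-< A vm<vn 0<i i<I) (weight-monoʳ A≤α)) iα≤IA

  exponent-decreases : ∀ {i I α A} → vn < vm → 0 < i → i < I → weight I A ≤ᶠ weight i α → A < α
  exponent-decreases {i} {I} {α} {A} vn<vm 0<i i<I IA≤iα = ℕ.≰⇒> λ α≤A →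
    <ᶠ⇒≱ᶠ (≤ᶠ-<ᶠ-trans (weight-positive α 0<i) (weight-positive A 0<i) (weight-monoʳ α≤A) (weight-index-> A vn<vm 0<i i<I)) IA≤iα

  zpow-<⇒weight-< : ∀ {i vi} → 0 < i → zpow m i (vi ⊖ vn) ℚ.< zpow n i (vi ⊖ vm) → weight m vm <ᶠ weight i vi
  zpow-<⇒weight-< {i} {vi} 0<i zpow<zpow
    with represents-< (represents-zpow vi vn 0<m 0<i) (represents-zpow vi vm 0<n 0<i) zpow<zpow
  ... | *<* cross = *<* (≡.subst₂ _<_ (rearrange (m ^ vi) (i ^ vn) (n ^ vm) (m ^ vm)) (rearrange′ (n ^ vi) (i ^ vm) (m ^ vn) (m ^ vm))
                          (ℕ.*-monoˡ-< (m ^ vm) {{ℕ.>-nonZero (^-positive vm 0<m)}} A<B))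
    where
    A = m ^ vi * i ^ vn * n ^ vm
    B = n ^ vi * i ^ vm * m ^ vn
    A<B : A < B
    A<B = ℕ.*-cancelʳ-< (i ^ vi) A B (≡.subst₂ _<_ (cancel-form (m ^ vi) (i ^ vn) (n ^ vm) (i ^ vi))
                                                      (cancel-form (n ^ vi) (i ^ vm) (m ^ vn) (i ^ vi)) cross)
      where
      cancel-form : ∀ a b c d → (a * b) * (d * c) ≡ (a * b * c) * d
      cancel-form = solve 4 (λ a b c d → (a ⊕ b) ⊕ (d ⊕ c) ⊜ ((a ⊕ b) ⊕ c) ⊕ d) ≡.refl
    rearrange : ∀ a b c d → (a * b * c) * d ≡ (c * d) * (a * b)
    rearrange = solve 4 (λ a b c d → ((a ⊕ b) ⊕ c) ⊕ d ⊜ (c ⊕ d) ⊕ (a ⊕ b)) ≡.refl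
    rearrange′ : ∀ a b c d → (a * b * c) * d ≡ (a * b) * (d * c)
    rearrange′ = solve 4 (λ a b c d → ((a ⊕ b) ⊕ c) ⊕ d ⊜ (a ⊕ b) ⊕ (d ⊕ c)) ≡.refl

-- Valuations of natural numbers

module NatValuation {q : ℕ} (q-prime : Prime q) where
  open import Data.Nat using (_+_; _*_; _^_; _≤_; _<_)
  open import Data.Nat.Divisibility using (_∣_; divides)
  open CommutativeMonoidSolver ℕ.*-1-commutativeMonoid using (solve; _⊕_; _⊜_)
  instance
    q≢0 : NonZero q
    q≢0 = prime⇒nonZero q-prime

  1<q : 1 < q
  1<q = ℕ.nonTrivial⇒n>1 q {{prime⇒nonTrivial q-prime}}

  ^-∣-^ : ∀ {a b} → a ≤ b → q ^ a ∣ q ^ b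
  ^-∣-^ {a} a≤b with ℕ.m≤n⇒∃[o]m+o≡n a≤b
  ... | o , ≡.refl = divides (q ^ o) (≡.trans (ℕ.^-distribˡ-+-* q a o) (ℕ.*-comm (q ^ a) (q ^ o)))

  νℕ-unique : ∀ {x a b} → HasValℕ q x a → HasValℕ q x b → a ≡ b
  νℕ-unique (qᵃ∣x , qᵃ⁺¹∤x) (qᵇ∣x , qᵇ⁺¹∤x) = ℕ.≤-antisym
    (ℕ.≮⇒≥ λ b<a → qᵇ⁺¹∤x (ℕ.∣-trans (^-∣-^ b<a) qᵃ∣x))
    (ℕ.≮⇒≥ λ a<b → qᵃ⁺¹∤x (ℕ.∣-trans (^-∣-^ a<b) qᵇ∣x))

  νℕ-1 : HasValℕ q 1 0
  νℕ-1 = ℕ.∣-refl , λ q∣1 → ℕ.<⇒≱ (≡.subst (1 <_) (≡.sym (ℕ.*-identityʳ q)) 1<q) (ℕ.∣⇒≤ q∣1)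

  νℕ-* : ∀ {x y} a b → HasValℕ q x a → HasValℕ q y b → HasValℕ q (x * y) (a + b)
  νℕ-* {x} {y} a b (qᵃ∣x@(divides x′ x≡x′qᵃ) , qᵃ⁺¹∤x) (qᵇ∣y@(divides y′ y≡y′qᵇ) , qᵇ⁺¹∤y) =
    ≡.subst (_∣ x * y) (≡.sym (ℕ.^-distribˡ-+-* q a b)) (ℕ.*-pres-∣ qᵃ∣x qᵇ∣y) , qᵃ⁺ᵇ⁺¹∤xy
    where
    instance
      qᵃ⁺ᵇ≢0 : NonZero (q ^ (a + b))
      qᵃ⁺ᵇ≢0 = ℕ.m^n≢0 q (a + b)
    xy≡x′y′qᵃ⁺ᵇ : x * y ≡ x′ * y′ * q ^ (a + b)
    xy≡x′y′qᵃ⁺ᵇ = begin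
      x * y                          ≡⟨ ≡.cong₂ _*_ x≡x′qᵃ y≡y′qᵇ ⟩
      (x′ * q ^ a) * (y′ * q ^ b)
        ≡⟨ solve 4 (λ x qa y qb → (x ⊕ qa) ⊕ (y ⊕ qb) ⊜ (x ⊕ y) ⊕ (qa ⊕ qb)) ≡.refl x′ (q ^ a) y′ (q ^ b) ⟩
      (x′ * y′) * (q ^ a * q ^ b)    ≡⟨ ≡.cong (x′ * y′ *_) (ℕ.^-distribˡ-+-* q a b) ⟨
      x′ * y′ * q ^ (a + b)          ∎
      where open ≡.≡-Reasoning
    qᵃ⁺ᵇ⁺¹∤xy : ¬ (q ^ suc (a + b) ∣ x * y)
    qᵃ⁺ᵇ⁺¹∤xy qᵃ⁺ᵇ⁺¹∣xy with euclidsLemma x′ y′ q-prime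
                               (ℕ.*-cancelʳ-∣ (q ^ (a + b)) (≡.subst (q * q ^ (a + b) ∣_) xy≡x′y′qᵃ⁺ᵇ qᵃ⁺ᵇ⁺¹∣xy))
    ... | inj₁ (divides t x′≡tq) =
      qᵃ⁺¹∤x (divides t (≡.trans x≡x′qᵃ (≡.trans (≡.cong (_* q ^ a) x′≡tq) (ℕ.*-assoc t q (q ^ a)))))
    ... | inj₂ (divides t y′≡tq) =
      qᵇ⁺¹∤y (divides t (≡.trans y≡y′qᵇ (≡.trans (≡.cong (_* q ^ b) y′≡tq) (ℕ.*-assoc t q (q ^ b)))))

  νℕ-^ : ∀ {x} a k → HasValℕ q x a → HasValℕ q (x ^ k) (k * a)
  νℕ-^ a zero    _    = νℕ-1
  νℕ-^ a (suc k) νx≡a = νℕ-* a (k * a) νx≡a (νℕ-^ a k νx≡a)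

  n<qⁿ : ∀ x → x < q ^ x
  n<qⁿ zero    = s≤s z≤n
  n<qⁿ (suc x) = ℕ.<-≤-trans (s≤s (n<qⁿ x)) (begin
    suc (q ^ x)    ≤⟨ ℕ.+-monoˡ-≤ (q ^ x) (ℕ.m^n>0 q x) ⟩
    q ^ x + q ^ x  ≡⟨ ≡.cong (q ^ x +_) (ℕ.+-identityʳ (q ^ x)) ⟨
    2 * q ^ x      ≤⟨ ℕ.*-monoˡ-≤ (q ^ x) 1<q ⟩
    q * q ^ x      ∎)
    where open ℕ.≤-Reasoning

  νℕ-exists : ∀ {x} → 0 < x → ∃ λ e → HasValℕ q x e
  νℕ-exists {x} 0<x = below x (λ qˣ∣x → ℕ.<⇒≱ (n<qⁿ x) (ℕ.∣⇒≤ {{ℕ.>-nonZero 0<x}} qˣ∣x))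
    where
    below : ∀ L → ¬ (q ^ L ∣ x) → ∃ λ e → HasValℕ q x e
    below zero    q⁰∤x   = contradiction (ℕ.1∣ x) q⁰∤x
    below (suc L) qᴸ⁺¹∤x with q ^ L ∣? x
    ... | yes qᴸ∣x = L , qᴸ∣x , qᴸ⁺¹∤x
    ... | no  qᴸ∤x = below L qᴸ∤x

module ExponentArithmetic where
  open import Data.Nat using (_+_; _*_; _≤_; _<_; _∸_)
  open import Data.Nat.Divisibility using (_∣_; divides)
  open import Data.Integer as ℤ using (ℤ; +_; _⊖_; ∣_∣)
  import Data.Integer.Properties as ℤ
  open import Data.Nat.GCD using (gcd; gcd[m,n]∣m; gcd[m,n]∣n; gcd[m,n]≢0)
  open import Data.Nat.Coprimality using (coprime-/gcd; coprime-divisor)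
  import Data.Nat.Coprimality as Coprime

  ∣n⊖m∣≡n∸m : ∀ {m n} → m ≤ n → ∣ n ⊖ m ∣ ≡ n ∸ m
  ∣n⊖m∣≡n∸m {m} {n} m≤n = ≡.trans (ℤ.∣m⊖n∣≡∣n⊖m∣ n m) (ℤ.∣⊖∣-≤ m≤n)

  exponent-gap : ∀ {α A β B γ u w} → α < A → β < B → γ + u ≡ α + β → γ + w ≡ A + B →
                 0 < ∣ A ⊖ α ∣ × ∣ A ⊖ α ∣ < ∣ w ⊖ u ∣
  exponent-gap {α} {A} {β} {B} {γ} {u} {w} α<A β<B γ+u≡α+β γ+w≡A+B
    with ℕ.m≤n⇒∃[o]m+o≡n α<A | ℕ.m≤n⇒∃[o]m+o≡n β<B
  ... | s , ≡.refl | t , ≡.refl = ≡.subst (0 <_) (≡.sym ∣A⊖α∣≡1+s) (s≤s z≤n) ,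
    ≡.subst₂ _<_ (≡.sym ∣A⊖α∣≡1+s) (≡.sym ∣w⊖u∣≡1+s+1+t) (ℕ.m<m+n (suc s) (s≤s z≤n))
    where
    w≡u+1+s+1+t : w ≡ u + (suc s + suc t)
    w≡u+1+s+1+t = ℕ.+-cancelˡ-≡ γ w _ (begin
      γ + w                        ≡⟨ γ+w≡A+B ⟩
      (suc α + s) + (suc β + t)    ≡⟨ shuffle α s β t ⟩
      (α + β) + (suc s + suc t)    ≡⟨ ≡.cong (_+ (suc s + suc t)) γ+u≡α+β ⟨
      (γ + u) + (suc s + suc t)    ≡⟨ ℕ.+-assoc γ u _ ⟩
      γ + (u + (suc s + suc t))    ∎)
      where
      open ≡.≡-Reasoning
      shuffle : ∀ α s β t → (suc α + s) + (suc β + t) ≡ (α + β) + (suc s + suc t)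
      shuffle = solve 4 (λ α s β t → (con 1 :+ α :+ s) :+ (con 1 :+ β :+ t) := (α :+ β) :+ ((con 1 :+ s) :+ (con 1 :+ t))) ≡.refl
        where open import Data.Nat.Solver using (module +-*-Solver)
              open +-*-Solver using (solve; _:=_; _:+_; con)
    ∣A⊖α∣≡1+s : ∣ (suc α + s) ⊖ α ∣ ≡ suc s
    ∣A⊖α∣≡1+s = ≡.trans (∣n⊖m∣≡n∸m (ℕ.<⇒≤ α<A))
                        (≡.trans (≡.cong (_∸ α) (≡.sym (ℕ.+-suc α s))) (ℕ.m+n∸m≡n α (suc s)))
    ∣w⊖u∣≡1+s+1+t : ∣ w ⊖ u ∣ ≡ suc s + suc t
    ∣w⊖u∣≡1+s+1+t = ≡.trans (≡.cong (λ e → ∣ e ⊖ u ∣) w≡u+1+s+1+t)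
                            (≡.trans (∣n⊖m∣≡n∸m (ℕ.m≤m+n u _)) (ℕ.m+n∸m≡n u _))

  gcd≢0 : ∀ a {D} → 0 < D → NonZero (gcd a D)
  gcd≢0 a {D} 0<D = ℕ.≢-nonZero (gcd[m,n]≢0 a D (inj₂ (ℕ.>⇒≢ 0<D)))

  [n/gcd[m,n]]∣o : ∀ {a D x y} (0<D : 0 < D) → a * x ≡ D * y → (D / gcd a D) {{gcd≢0 a 0<D}} ∣ x
  [n/gcd[m,n]]∣o {a} {D} {x} {y} 0<D ax≡Dy =
    coprime-divisor (Coprime.sym (coprime-/gcd a D)) (divides y a′x≡yD′)
    where
    instance
      g≢0 : NonZero (gcd a D)
      g≢0 = gcd≢0 a 0<D
    g = gcd a D
    a′x≡yD′ : a / g * x ≡ y * (D / g)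
    a′x≡yD′ = ℕ.*-cancelʳ-≡ _ _ g (begin
      a / g * x * g    ≡⟨ ℕ.*-assoc (a / g) x g ⟩
      a / g * (x * g)  ≡⟨ ≡.cong (a / g *_) (ℕ.*-comm x g) ⟩
      a / g * (g * x)  ≡⟨ ℕ.*-assoc (a / g) g x ⟨
      a / g * g * x    ≡⟨ ≡.cong (_* x) (m/n*n≡m (gcd[m,n]∣m a D)) ⟩
      a * x            ≡⟨ ax≡Dy ⟩
      D * y            ≡⟨ ≡.cong (_* y) (m/n*n≡m (gcd[m,n]∣n a D)) ⟨
      D / g * g * y    ≡⟨ ℕ.*-comm (D / g * g) y ⟩
      y * (D / g * g)  ≡⟨ ℕ.*-assoc y (D / g) g ⟨
      y * (D / g) * g  ∎)
      where open ≡.≡-Reasoning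

  valuation-identity : ∀ α A en em fi fI vm vn →
    (α * en + vm * fi) + (A * em + vn * fI) ≡ (A * en + vm * fI) + (α * em + vn * fi) →
    ∣ A ⊖ α ∣ * ∣ en ⊖ em ∣ ≡ ∣ vn ⊖ vm ∣ * ∣ fI ⊖ fi ∣
  valuation-identity α A en em fi fI vm vn L≡R = begin
    ∣ A ⊖ α ∣ * ∣ en ⊖ em ∣              ≡⟨ ℤ.abs-* (A ⊖ α) (en ⊖ em) ⟨
    ∣ (A ⊖ α) ℤ.* (en ⊖ em) ∣            ≡⟨ ≡.cong ∣_∣ integer-identity ⟩
    ∣ (vn ⊖ vm) ℤ.* (fI ⊖ fi) ∣          ≡⟨ ℤ.abs-* (vn ⊖ vm) (fI ⊖ fi) ⟩
    ∣ vn ⊖ vm ∣ * ∣ fI ⊖ fi ∣            ∎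
    where
    open ≡.≡-Reasoning
    open import Data.Integer.Solver using () renaming (module +-*-Solver to ℤ-Solver)
    open ℤ-Solver using (solve; _:=_; _:+_; _:*_; _:-_)
    cast : ∀ a b c d e f g h → + ((a * b + c * d) + (e * f + g * h))
                             ≡ (+ a ℤ.* + b ℤ.+ + c ℤ.* + d) ℤ.+ (+ e ℤ.* + f ℤ.+ + g ℤ.* + h)
    cast a b c d e f g h = ≡.trans (ℤ.pos-+ (a * b + c * d) (e * f + g * h)) (≡.cong₂ ℤ._+_
      (≡.trans (ℤ.pos-+ (a * b) (c * d)) (≡.cong₂ ℤ._+_ (ℤ.pos-* a b) (ℤ.pos-* c d)))
      (≡.trans (ℤ.pos-+ (e * f) (g * h)) (≡.cong₂ ℤ._+_ (ℤ.pos-* e f) (ℤ.pos-* g h))))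
    L R : ℤ
    L = (+ α ℤ.* + en ℤ.+ + vm ℤ.* + fi) ℤ.+ (+ A ℤ.* + em ℤ.+ + vn ℤ.* + fI)
    R = (+ A ℤ.* + en ℤ.+ + vm ℤ.* + fI) ℤ.+ (+ α ℤ.* + em ℤ.+ + vn ℤ.* + fi)
    L≡Rᶻ : L ≡ R
    L≡Rᶻ = ≡.trans (≡.sym (cast α en vm fi A em vn fI)) (≡.trans (≡.cong +_ L≡R) (cast A en vm fI α em vn fi))
    expand : (+ A ℤ.- + α) ℤ.* (+ en ℤ.- + em) ≡ (+ vn ℤ.- + vm) ℤ.* (+ fI ℤ.- + fi) ℤ.+ (R ℤ.- L)
    expand = solve 8 (λ α A en em fi fI vm vn →
      (A :- α) :* (en :- em) := (vn :- vm) :* (fI :- fi) :+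
        (((A :* en :+ vm :* fI) :+ (α :* em :+ vn :* fi)) :- ((α :* en :+ vm :* fi) :+ (A :* em :+ vn :* fI))))
      ≡.refl (+ α) (+ A) (+ en) (+ em) (+ fi) (+ fI) (+ vm) (+ vn)
    integer-identity : (A ⊖ α) ℤ.* (en ⊖ em) ≡ (vn ⊖ vm) ℤ.* (fI ⊖ fi)
    integer-identity = begin
      (A ⊖ α) ℤ.* (en ⊖ em)                                   ≡⟨ ≡.cong₂ ℤ._*_ (ℤ.m-n≡m⊖n A α) (ℤ.m-n≡m⊖n en em) ⟨
      (+ A ℤ.- + α) ℤ.* (+ en ℤ.- + em)                       ≡⟨ expand ⟩
      (+ vn ℤ.- + vm) ℤ.* (+ fI ℤ.- + fi) ℤ.+ (R ℤ.- L)       ≡⟨ ≡.cong (λ r → (+ vn ℤ.- + vm) ℤ.* (+ fI ℤ.- + fi) ℤ.+ (r ℤ.- L)) L≡Rᶻ ⟨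
      (+ vn ℤ.- + vm) ℤ.* (+ fI ℤ.- + fi) ℤ.+ (L ℤ.- L)       ≡⟨ ≡.cong (λ r → (+ vn ℤ.- + vm) ℤ.* (+ fI ℤ.- + fi) ℤ.+ r) (ℤ.+-inverseʳ L) ⟩
      (+ vn ℤ.- + vm) ℤ.* (+ fI ℤ.- + fi) ℤ.+ + 0             ≡⟨ ℤ.+-identityʳ _ ⟩
      (+ vn ℤ.- + vm) ℤ.* (+ fI ℤ.- + fi)                     ≡⟨ ≡.cong₂ ℤ._*_ (ℤ.m-n≡m⊖n vn vm) (ℤ.m-n≡m⊖n fI fi) ⟩
      (vn ⊖ vm) ℤ.* (fI ⊖ fi)                                 ∎

ExponentsCoprime : (m n vm vn : ℕ) → Set
ExponentsCoprime m n vm vn = ∀ d → d ∣ ∣ vn ⊖ vm ∣ →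
  (∀ q → Prime q → q ∣ m * n → ∀ en em → HasValℕ q n en → HasValℕ q m em → d ∣ ∣ en ⊖ em ∣) → d ≡ 1
  where
  open import Data.Nat using (_*_)
  open import Data.Nat.Divisibility using (_∣_)
  open import Data.Integer using (∣_∣)

module SlopeArithmetic (m n vm vn : ℕ) (0<m : 0 ℕ.< m) (m≤n : m ℕ.≤ n) where
  open import Data.Nat using (_+_; _*_; _^_; _≤_; _<_)
  open import Data.Nat.Divisibility using (_∣_)
  open ExponentArithmetic
  open import Data.Integer as ℤ using (_⊖_; ∣_∣)
  import Data.Integer.Properties as ℤ
  open import Data.Nat.GCD using (gcd; gcd[m,n]∣m; gcd[m,n]∣n)
  open import Relation.Binary.Definitions using (tri<; tri≈; tri>)
  open Fraction
  open Weight m n vm vn 0<m m≤n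

  νℕ-weight-cross : ∀ {q en em fi fI i I α A} → Prime q →
    HasValℕ q n en → HasValℕ q m em → HasValℕ q i fi → HasValℕ q I fI → weight i α ≃ᶠ weight I A →
    ∣ A ⊖ α ∣ * ∣ en ⊖ em ∣ ≡ ∣ vn ⊖ vm ∣ * ∣ fI ⊖ fi ∣
  νℕ-weight-cross {q} {en} {em} {fi} {fI} {i} {I} {α} {A} q-prime νn νm νi νI (*≤* iα≤IA , *≤* IA≤iα) =
    valuation-identity α A en em fi fI vm vn (νℕ-unique νℕ-lhs
      (≡.subst (λ k → HasValℕ q k ((A * en + vm * fI) + (α * em + vn * fi))) (≡.sym cross≡) νℕ-rhs))
    where
    open NatValuation q-prime
    cross≡ : (n ^ α * i ^ vm) * (m ^ A * I ^ vn) ≡ (n ^ A * I ^ vm) * (m ^ α * i ^ vn)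
    cross≡ = ℕ.≤-antisym iα≤IA IA≤iα
    νℕ-lhs : HasValℕ q ((n ^ α * i ^ vm) * (m ^ A * I ^ vn)) ((α * en + vm * fi) + (A * em + vn * fI))
    νℕ-lhs = νℕ-* (α * en + vm * fi) (A * em + vn * fI) (νℕ-* (α * en) (vm * fi) (νℕ-^ en α νn) (νℕ-^ fi vm νi))
                      (νℕ-* (A * em) (vn * fI) (νℕ-^ em A νm) (νℕ-^ fI vn νI))
    νℕ-rhs : HasValℕ q ((n ^ A * I ^ vm) * (m ^ α * i ^ vn)) ((A * en + vm * fI) + (α * em + vn * fi))
    νℕ-rhs = νℕ-* (A * en + vm * fI) (α * em + vn * fi) (νℕ-* (A * en) (vm * fI) (νℕ-^ en A νn) (νℕ-^ fI vm νI))
                      (νℕ-* (α * em) (vn * fi) (νℕ-^ em α νm) (νℕ-^ fi vn νi))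

  exponent-gap-by-sign : ∀ {i I j J α A β B γ} → vn ≢ vm → 0 < i → i < I → 0 < j → j < J →
    γ + vm ≡ α + β → γ + vn ≡ A + B → weight i α ≃ᶠ weight I A → weight j β ≃ᶠ weight J B →
    0 < ∣ A ⊖ α ∣ × ∣ A ⊖ α ∣ < ∣ vn ⊖ vm ∣
  exponent-gap-by-sign {i} {I} {j} {J} {α} {A} {β} {B} {γ} vn≢vm 0<i i<I 0<j j<J γ+vm≡α+β γ+vn≡A+B iα≃IA jβ≃JB
    with ℕ.<-cmp vm vn
  ... | tri< vm<vn _ _ = exponent-gap {γ = γ} (exponent-increases {i} {I} {α} {A} vm<vn 0<i i<I (proj₁ iα≃IA))
                                      (exponent-increases {j} {J} {β} {B} vm<vn 0<j j<J (proj₁ jβ≃JB)) γ+vm≡α+β γ+vn≡A+B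
  ... | tri≈ _ vm≡vn _ = contradiction (≡.sym vm≡vn) vn≢vm
  ... | tri> _ _ vn<vm = reverse (exponent-gap {γ = γ} (exponent-decreases {i} {I} {α} {A} vn<vm 0<i i<I (proj₂ iα≃IA))
                                         (exponent-decreases {j} {J} {β} {B} vn<vm 0<j j<J (proj₂ jβ≃JB)) γ+vn≡A+B γ+vm≡α+β)
    where
    reverse : 0 < ∣ α ⊖ A ∣ × ∣ α ⊖ A ∣ < ∣ vm ⊖ vn ∣ → 0 < ∣ A ⊖ α ∣ × ∣ A ⊖ α ∣ < ∣ vn ⊖ vm ∣
    reverse (0<gap , gap<D) rewrite ℤ.∣m⊖n∣≡∣n⊖m∣ α A | ℤ.∣m⊖n∣≡∣n⊖m∣ vm vn = 0<gap , gap<D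

  -- Condition (iii) for d = D / gcd(gap, D) gives gcd(gap, D) = D, so D ∣ gap, though 0 < gap < D.
  slope-contradiction : ∀ {i I j J α A β B γ} → vn ≢ vm → 0 < i → i < I → 0 < j → j < J →
    γ + vm ≡ α + β → γ + vn ≡ A + B → weight i α ≃ᶠ weight I A → weight j β ≃ᶠ weight J B →
    ExponentsCoprime m n vm vn → ⊥
  slope-contradiction {i} {I} {j} {J} {α} {A} {β} {B} {γ} vn≢vm 0<i i<I 0<j j<J γ+vm≡α+β γ+vn≡A+B iα≃IA jβ≃JB coprime =
    ℕ.<⇒≱ gap<D (ℕ.∣⇒≤ {{ℕ.>-nonZero 0<gap}} D∣gap)
    where
    gap = ∣ A ⊖ α ∣
    D = ∣ vn ⊖ vm ∣
    bounds = exponent-gap-by-sign {i} {I} {j} {J} {α} {A} {β} {B} {γ} vn≢vm 0<i i<I 0<j j<J γ+vm≡α+β γ+vn≡A+B iα≃IA jβ≃JB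
    0<gap = proj₁ bounds
    gap<D = proj₂ bounds
    0<D : 0 < D
    0<D = ℕ.<-trans 0<gap gap<D
    instance
      g≢0 : NonZero (gcd gap D)
      g≢0 = gcd≢0 gap 0<D
    d∣exponents : ∀ q → Prime q → q ∣ m * n → ∀ en em → HasValℕ q n en → HasValℕ q m em → D / gcd gap D ∣ ∣ en ⊖ em ∣
    d∣exponents q q-prime _ en em νn νm with NatValuation.νℕ-exists q-prime 0<i | NatValuation.νℕ-exists q-prime (ℕ.<-trans 0<i i<I)
    ... | fi , νi | fI , νI = [n/gcd[m,n]]∣o {gap} {D} {∣ en ⊖ em ∣} {∣ fI ⊖ fi ∣} 0<D
      (νℕ-weight-cross {q} {en} {em} {fi} {fI} {i} {I} {α} {A} q-prime νn νm νi νI iα≃IA)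
    d≡1 : D / gcd gap D ≡ 1
    d≡1 = coprime _ (ℕ.m/n∣m (gcd[m,n]∣n gap D)) d∣exponents
    gcd≡D : gcd gap D ≡ D
    gcd≡D = ≡.trans (≡.sym (ℕ.*-identityˡ _)) (≡.trans (≡.cong (_* gcd gap D) (≡.sym d≡1)) (m/n*n≡m (gcd[m,n]∣n gap D)))
    D∣gap : D ∣ gap
    D∣gap = ≡.subst (_∣ gap) gcd≡D (gcd[m,n]∣m gap D)

-- Extremal elements of bounded decidable sets of naturals

Least : ∀ {s r} → (ℕ → ℕ → Set r) → Pred ℕ s → Pred ℕ (s ⊔ r)
Least _≼_ S T = S T × ∀ j → S j → T ≼ j

module Extrema {s r} (S : Pred ℕ s) (S? : Decidable S)
  {_≼_ : ℕ → ℕ → Set r} (_≼?_ : ∀ a b → Dec (a ≼ b)) (≼-refl : ∀ {a} → a ≼ a)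
  (≼-total : ∀ {a b} → ¬ (a ≼ b) → b ≼ a) (≼-trans : ∀ {a b c} → S b → a ≼ b → b ≼ c → a ≼ c) where

  private
    case-<1+ : ∀ {a} {A : Set a} {j N} → j ℕ.< suc N → (j ℕ.< N → A) → (j ≡ N → A) → A
    case-<1+ j<1+N below at = [ below , at ]′ (ℕ.m<1+n⇒m<n∨m≡n j<1+N)

  least-below : ∀ N → (∀ j → j ℕ.< N → ¬ S j) ⊎ ∃ λ T → S T × ∀ j → j ℕ.< N → S j → T ≼ j
  least-below zero = inj₁ λ _ ()
  least-below (suc N) with least-below N | S? N
  ... | inj₁ none | no ¬sN = inj₁ λ j j<1+N → case-<1+ j<1+N (none j) λ { ≡.refl → ¬sN }
  ... | inj₁ none | yes sN = inj₂ (N , sN , λ j j<1+N sj →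
          case-<1+ j<1+N (λ j<N → contradiction sj (none j j<N)) λ { ≡.refl → ≼-refl })
  ... | inj₂ (T , sT , T≼) | no ¬sN = inj₂ (T , sT , λ j j<1+N sj →
          case-<1+ j<1+N (λ j<N → T≼ j j<N sj) λ { ≡.refl → contradiction sj ¬sN })
  ... | inj₂ (T , sT , T≼) | yes sN with T ≼? N
  ...   | yes T≼N = inj₂ (T , sT , λ j j<1+N sj → case-<1+ j<1+N (λ j<N → T≼ j j<N sj) λ { ≡.refl → T≼N })
  ...   | no  T⋠N = inj₂ (N , sN , λ j j<1+N sj →
          case-<1+ j<1+N (λ j<N → ≼-trans sT (≼-total T⋠N) (T≼ j j<N sj)) λ { ≡.refl → ≼-refl })

  least : ∀ N → (∀ j → S j → j ℕ.< N) → ∀ {w} → S w → ∃ (Least _≼_ S)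
  least N bounded {w} sw with least-below N
  ... | inj₁ none           = contradiction sw (none w (bounded w sw))
  ... | inj₂ (T , sT , T≼) = T , sT , λ j sj → T≼ j (bounded j sj) sj

module _ {s} {S : Pred ℕ s} (S? : Decidable S) (N : ℕ) (bounded : ∀ j → S j → j ℕ.< N) where

  least-index : ∀ {w} → S w → ∃ (Least ℕ._≤_ S)
  least-index = Extrema.least S S? ℕ._≤?_ ℕ.≤-refl (λ a≰b → ℕ.<⇒≤ (ℕ.≰⇒> a≰b)) (λ _ → ℕ.≤-trans) N bounded

  greatest-index : ∀ {w} → S w → ∃ (Least ℕ._≥_ S)
  greatest-index = Extrema.least S S? (λ a b → b ℕ.≤? a) ℕ.≤-refl (λ a≱b → ℕ.<⇒≤ (ℕ.≰⇒> a≱b))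
                                 (λ _ b≤a c≤b → ℕ.≤-trans c≤b b≤a) N bounded

greatest-least : ∀ {s r} {S : Pred ℕ s} (S? : Decidable S) {_≼_ : ℕ → ℕ → Set r} (_≼?_ : ∀ a b → Dec (a ≼ b))
  (≼-refl : ∀ {a} → a ≼ a) (≼-total : ∀ {a b} → ¬ (a ≼ b) → b ≼ a)
  (≼-trans : ∀ {a b c} → S b → a ≼ b → b ≼ c → a ≼ c) →
  ∀ N → (∀ j → S j → j ℕ.< N) → ∀ {w} → S w → ∃ λ T → Least _≼_ S T × (∀ j → S j → j ≼ T → j ℕ.≤ T)
greatest-least {S = S} S? {_≼_} _≼?_ ≼-refl ≼-total ≼-trans N bounded sw
  with Extrema.least S S? _≼?_ ≼-refl ≼-total ≼-trans N bounded sw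
... | T′ , sT′ , T′≼ with greatest-index (λ j → S? j ×-dec (j ≼? T′)) N (λ j → bounded j ∘ proj₁) (sT′ , ≼-refl)
...   | T , (sT , T≼T′) , T-greatest =
  T , (sT , λ j sj → ≼-trans sT′ T≼T′ (T′≼ j sj)) , λ j sj j≼T → T-greatest j (sj , ≼-trans sT j≼T T≼T′)

-- The Newton polygon argument

*-mono-<-≤ : ∀ {a b c d} → a ℕ.< b → c ℕ.≤ d → 0 ℕ.< c → a ℕ.* c ℕ.< b ℕ.* d
*-mono-<-≤ {b = b} {c} a<b c≤d 0<c = ℕ.<-≤-trans (ℕ.*-monoˡ-< c {{ℕ.>-nonZero 0<c}} a<b) (ℕ.*-monoʳ-≤ b c≤d)

module NewtonPolygon {c ℓ : Level} (R : CommutativeRing c ℓ) (dom : IsIntegralDomain R)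
                     (p : CommutativeRing.Carrier R) (prime : IsPrimeElt R p) where
  open CommutativeRing R
  open DividesProperties R
  open IntegralDomainProperties R dom
  open PAdicValuation R dom p prime
  open DirichletProduct R using (dmul-closed; dmul-split)

  Support : (ℕ → Carrier) → Pred ℕ ℓ
  Support F j = ¬ (F j ≈ 0#)

  module ValuedCoefficients {F : ℕ → Carrier} (valued : Valued F) where
    support? : Decidable (Support F)
    support? j with valued j
    ... | inj₁ Fj≈0         = no λ Fj≉0 → Fj≉0 Fj≈0
    ... | inj₂ (v , νFj≡v) = yes (ν⇒≉0 νFj≡v)

    ν : ℕ → ℕ
    ν j with valued j
    ... | inj₁ _       = 0   -- junk outside the support
    ... | inj₂ (v , _) = v

    ν-support : ∀ {j} → Support F j → ν[ F j ]≡ ν j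
    ν-support {j} Fj≉0 with valued j
    ... | inj₁ Fj≈0         = contradiction Fj≈0 Fj≉0
    ... | inj₂ (_ , νFj≡v) = νFj≡v

    outside-support : ∀ {j} → ¬ Support F j → F j ≈ 0#
    outside-support {j} ¬Fj≉0 with valued j
    ... | inj₁ Fj≈0         = Fj≈0
    ... | inj₂ (v , νFj≡v) = contradiction (ν⇒≉0 νFj≡v) ¬Fj≉0

  module ProductSupport {G H : ℕ → Carrier} (valuedG : Valued G) (valuedH : Valued H) where
    module G = ValuedCoefficients valuedG
    module H = ValuedCoefficients valuedH

    term-cases : ∀ j l → (Support G j × Support H l) ⊎ (G j * H l ≈ 0#)
    term-cases j l with G.support? j | H.support? l
    ... | yes Gj≉0 | yes Hl≉0 = inj₁ (Gj≉0 , Hl≉0)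
    ... | no ¬Gj≉0 | _        = inj₂ (trans (*-congʳ (G.outside-support ¬Gj≉0)) (zeroˡ _))
    ... | yes _    | no ¬Hl≉0 = inj₂ (trans (*-congˡ (H.outside-support ¬Hl≉0)) (zeroʳ _))

    term-exists : ∀ k → Support (dmul R G H) k → ∃₂ λ j l → j ℕ.* l ≡ k × Support G j × Support H l
    term-exists k G*Hk≉0 with dmul-closed Q Q-resp (inj₁ refl) Q-+ G H k classify
      where
      Q : Carrier → Set ℓ
      Q x = x ≈ 0# ⊎ ∃₂ λ j l → j ℕ.* l ≡ k × Support G j × Support H l
      Q-resp : ∀ {x y} → x ≈ y → Q x → Q y
      Q-resp x≈y (inj₁ x≈0) = inj₁ (trans (sym x≈y) x≈0)
      Q-resp _   (inj₂ t)   = inj₂ t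
      Q-+ : ∀ {x y} → Q x → Q y → Q (x + y)
      Q-+ (inj₁ x≈0) (inj₁ y≈0) = inj₁ (trans (+-cong x≈0 y≈0) (+-identityʳ 0#))
      Q-+ (inj₁ _)   (inj₂ t)   = inj₂ t
      Q-+ (inj₂ t)   _          = inj₂ t
      classify : ∀ j l → j ℕ.* l ≡ k → Q (G j * H l)
      classify j l jl≡k with term-cases j l
      ... | inj₁ (Gj≉0 , Hl≉0) = inj₂ (j , l , jl≡k , Gj≉0 , Hl≉0)
      ... | inj₂ GjHl≈0        = inj₁ GjHl≈0
    ... | inj₁ G*Hk≈0 = contradiction G*Hk≈0 G*Hk≉0
    ... | inj₂ t      = t

    -- The other terms are divisible by p^(V+1), V = νG j₀ + νH l₀, so they do not change the valuation.
    ν-dmul : ∀ j₀ l₀ → 0 ℕ.< j₀ → 0 ℕ.< l₀ → Support G j₀ → Support H l₀ →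
      (∀ j l → j ℕ.* l ≡ j₀ ℕ.* l₀ → j ≢ j₀ → Support G j → Support H l → G.ν j₀ ℕ.+ H.ν l₀ ℕ.< G.ν j ℕ.+ H.ν l) →
      ν[ dmul R G H (j₀ ℕ.* l₀) ]≡ G.ν j₀ ℕ.+ H.ν l₀
    ν-dmul j₀ l₀ 0<j₀ 0<l₀ Gj₀≉0 Hl₀≉0 heavier
      with dmul-split (p ^ suc V ∣_) ∣-respʳ ((p ^ suc V) ∣0) ∣-+ G H j₀ l₀ {{ℕ.>-nonZero 0<j₀}} {{ℕ.>-nonZero 0<l₀}} divisible
      where
      V = G.ν j₀ ℕ.+ H.ν l₀
      divisible : ∀ j l → j ℕ.* l ≡ j₀ ℕ.* l₀ → j ≢ j₀ → p ^ suc V ∣ G j * H l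
      divisible j l jl≡k j≢j₀ with term-cases j l
      ... | inj₁ (Gj≉0 , Hl≉0) = ∣-trans (^-∣-^ p (heavier j l jl≡k j≢j₀ Gj≉0 Hl≉0))
                                         (^-∣-*-^ p {G.ν j} {H.ν l} (ν[_]≡_.divides (G.ν-support Gj≉0)) (ν[_]≡_.divides (H.ν-support Hl≉0)))
      ... | inj₂ GjHl≈0        = ∣-respʳ (sym GjHl≈0) ((p ^ suc V) ∣0)
    ... | r , pⱽ⁺¹∣r , G*H≈t+r = ν-resp (sym G*H≈t+r) (ν-+ (ν-* (G.ν-support Gj₀≉0) (H.ν-support Hl₀≉0)) pⱽ⁺¹∣r)

  support-positive : ∀ (F : ℕ → Carrier) → F 0 ≈ 0# → ∀ {j} → Support F j → 0 ℕ.< j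
  support-positive _ F0≈0 {zero}  F0≉0 = contradiction F0≈0 F0≉0
  support-positive _ _    {suc _} _    = s≤s z≤n

  support-bounded : ∀ {F} → IsDirichletPoly R F → ∃ λ N → ∀ j → Support F j → j ℕ.< N
  support-bounded (N , vanishes) = suc N , λ j Fj≉0 → s≤s (ℕ.≮⇒≥ λ N<j → Fj≉0 (vanishes j N<j))

  module SupportExtremes {F : ℕ → Carrier} (valued : Valued F) (F0≈0 : F 0 ≈ 0#)
                         (poly : IsDirichletPoly R F) (nonconstant : IsNonconstant R F) where
    open ValuedCoefficients valued using (support?)
    private
      bound = support-bounded poly
      least = least-index support? (proj₁ bound) (proj₂ bound) (proj₂ (proj₂ nonconstant))
      greatest = greatest-index support? (proj₁ bound) (proj₂ bound) (proj₂ (proj₂ nonconstant))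

    min max : ℕ
    min = proj₁ least
    max = proj₁ greatest

    min∈ : Support F min
    min∈ = proj₁ (proj₂ least)
    max∈ : Support F max
    max∈ = proj₁ (proj₂ greatest)

    min≤ : ∀ j → Support F j → min ℕ.≤ j
    min≤ = proj₂ (proj₂ least)
    ≤max : ∀ j → Support F j → j ℕ.≤ max
    ≤max = proj₂ (proj₂ greatest)

    0<min : 0 ℕ.< min
    0<min = support-positive F F0≈0 min∈
    0<max : 0 ℕ.< max
    0<max = support-positive F F0≈0 max∈
    2≤max : 2 ℕ.≤ max
    2≤max = ℕ.≤-trans (proj₁ (proj₂ nonconstant)) (≤max _ (proj₂ (proj₂ nonconstant)))

  module NoFactorisation
    (a : ℕ → Carrier) (m n : ℕ) (1≤m : 1 ℕ.≤ m) (m≤n : m ℕ.≤ n)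
    (am≉0 : ¬ (a m ≈ 0#)) (an≉0 : ¬ (a n ≈ 0#))
    (support-a : ∀ i → ¬ (a i ≈ 0#) → m ℕ.≤ i × i ℕ.≤ n)
    (indices-coprime : ∀ d → (∀ i → ¬ (a i ≈ 0#) → d ℕ.∣ i) → d ≡ 1)
    (vm vn : ℕ) (νm : ν[ a m ]≡ vm) (νn : ν[ a n ]≡ vn) (vn≢vm : vn ≢ vm)
    (above-segment : ∀ i vi → m ℕ.< i → i ℕ.< n → ¬ (a i ≈ 0#) → HasVal R p (a i) vi →
                       zpow n i (vi ⊖ vm) ℚ.> zpow m i (vi ⊖ vn))
    (coprime : ExponentsCoprime m n vm vn)
    (F : ScaledFactorisation R a)
    (valuedG : Valued (ScaledFactorisation.G F)) (valuedH : Valued (ScaledFactorisation.H F))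
    (γ : ℕ) (νB : ν[ ScaledFactorisation.B F ]≡ γ)
    where
    open ScaledFactorisation F
    open Fraction
    open Weight m n vm vn 1≤m m≤n
    open SlopeArithmetic m n vm vn 1≤m m≤n using (slope-contradiction)
    open ProductSupport valuedG valuedH
    module G-ends = SupportExtremes valuedG G0≈0 G-poly G-nonconstant
    module H-ends = SupportExtremes valuedH H0≈0 H-poly H-nonconstant

    m<n : m ℕ.< n
    m<n with ℕ.m≤n⇒m<n∨m≡n m≤n
    ... | inj₁ m<n    = m<n
    ... | inj₂ ≡.refl = contradiction (ν-unique νn νm) vn≢vm

    ν-Ba : ∀ {k V} → 1 ℕ.≤ k → ν[ dmul R G H k ]≡ V → ν[ B * a k ]≡ V
    ν-Ba 1≤k = ν-resp (sym (Ba≈G*H _ 1≤k))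

    ν⇒a≉0 : ∀ {k V} → 1 ℕ.≤ k → ν[ dmul R G H k ]≡ V → ¬ (a k ≈ 0#)
    ν⇒a≉0 1≤k ν-G*H ak≈0 = ν⇒≉0 (ν-Ba 1≤k ν-G*H) (trans (*-congˡ ak≈0) (zeroʳ B))

    a-support⇒product : ∀ k → ¬ (a k ≈ 0#) → ∃₂ λ j l → j ℕ.* l ≡ k × Support G j × Support H l
    a-support⇒product k ak≉0 =
      term-exists k λ G*Hk≈0 → *-≉0 B≉0 ak≉0 (trans (Ba≈G*H k (ℕ.≤-trans 1≤m (proj₁ (support-a k ak≉0)))) G*Hk≈0)

    i₀ I₀ j₀ J₀ : ℕ
    i₀ = G-ends.min
    I₀ = G-ends.max
    j₀ = H-ends.min
    J₀ = H-ends.max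

    α₀ A₀ β₀ B₀ : ℕ
    α₀ = G.ν i₀
    A₀ = G.ν I₀
    β₀ = H.ν j₀
    B₀ = H.ν J₀


    ν-at-min : ν[ dmul R G H (i₀ ℕ.* j₀) ]≡ α₀ ℕ.+ β₀
    ν-at-min = ν-dmul i₀ j₀ G-ends.0<min H-ends.0<min G-ends.min∈ H-ends.min∈
      λ j l jl≡i₀j₀ j≢i₀ Gj≉0 Hl≉0 → contradiction jl≡i₀j₀ (ℕ.>⇒≢
      (*-mono-<-≤ (ℕ.≤∧≢⇒< (G-ends.min≤ j Gj≉0) (≡.≢-sym j≢i₀)) (H-ends.min≤ l Hl≉0) H-ends.0<min))

    ν-at-max : ν[ dmul R G H (I₀ ℕ.* J₀) ]≡ A₀ ℕ.+ B₀
    ν-at-max = ν-dmul I₀ J₀ G-ends.0<max H-ends.0<max G-ends.max∈ H-ends.max∈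
      λ j l jl≡I₀J₀ j≢I₀ Gj≉0 Hl≉0 → contradiction jl≡I₀J₀ (ℕ.<⇒≢
      (*-mono-<-≤ (ℕ.≤∧≢⇒< (G-ends.≤max j Gj≉0) j≢I₀) (H-ends.≤max l Hl≉0) (support-positive H H0≈0 Hl≉0)))

    m≡i₀j₀ : m ≡ i₀ ℕ.* j₀
    m≡i₀j₀ with a-support⇒product m am≉0
    ... | j , l , jl≡m , Gj≉0 , Hl≉0 = ℕ.≤-antisym
      (proj₁ (support-a _ (ν⇒a≉0 (ℕ.*-mono-≤ G-ends.0<min H-ends.0<min) ν-at-min)))
      (≡.subst (i₀ ℕ.* j₀ ℕ.≤_) jl≡m (ℕ.*-mono-≤ (G-ends.min≤ j Gj≉0) (H-ends.min≤ l Hl≉0)))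

    n≡I₀J₀ : n ≡ I₀ ℕ.* J₀
    n≡I₀J₀ with a-support⇒product n an≉0
    ... | j , l , jl≡n , Gj≉0 , Hl≉0 = ℕ.≤-antisym
      (≡.subst (ℕ._≤ I₀ ℕ.* J₀) jl≡n (ℕ.*-mono-≤ (G-ends.≤max j Gj≉0) (H-ends.≤max l Hl≉0)))
      (proj₂ (support-a _ (ν⇒a≉0 (ℕ.*-mono-≤ G-ends.0<max H-ends.0<max) ν-at-max)))

    γ+vm≡α₀+β₀ : γ ℕ.+ vm ≡ α₀ ℕ.+ β₀
    γ+vm≡α₀+β₀ = ν-unique (≡.subst (λ k → ν[ B * a k ]≡ γ ℕ.+ vm) m≡i₀j₀ (ν-* νB νm))
                          (ν-Ba (ℕ.*-mono-≤ G-ends.0<min H-ends.0<min) ν-at-min)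

    γ+vn≡A₀+B₀ : γ ℕ.+ vn ≡ A₀ ℕ.+ B₀
    γ+vn≡A₀+B₀ = ν-unique (≡.subst (λ k → ν[ B * a k ]≡ γ ℕ.+ vn) n≡I₀J₀ (ν-* νB νn))
                          (ν-Ba (ℕ.*-mono-≤ G-ends.0<max H-ends.0<max) ν-at-max)

    G-monomial⇒i₀≡1 : i₀ ≡ I₀ → i₀ ≡ 1
    G-monomial⇒i₀≡1 i₀≡I₀ = indices-coprime i₀ λ k ak≉0 → divides-k k (a-support⇒product k ak≉0)
      where
      divides-k : ∀ k → (∃₂ λ j l → j ℕ.* l ≡ k × Support G j × Support H l) → i₀ ℕ.∣ k
      divides-k k (j , l , jl≡k , Gj≉0 , _) = ℕ.divides l (≡.trans (≡.sym jl≡k) (≡.trans (≡.cong (ℕ._* l) j≡i₀) (ℕ.*-comm i₀ l)))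
        where
        j≡i₀ : j ≡ i₀
        j≡i₀ = ℕ.≤-antisym (≡.subst (j ℕ.≤_) (≡.sym i₀≡I₀) (G-ends.≤max j Gj≉0)) (G-ends.min≤ j Gj≉0)

    H-monomial⇒j₀≡1 : j₀ ≡ J₀ → j₀ ≡ 1
    H-monomial⇒j₀≡1 j₀≡J₀ = indices-coprime j₀ λ k ak≉0 → divides-k k (a-support⇒product k ak≉0)
      where
      divides-k : ∀ k → (∃₂ λ j l → j ℕ.* l ≡ k × Support G j × Support H l) → j₀ ℕ.∣ k
      divides-k k (j , l , jl≡k , _ , Hl≉0) = ℕ.divides j (≡.trans (≡.sym jl≡k) (≡.cong (j ℕ.*_) l≡j₀))
        where
        l≡j₀ : l ≡ j₀
        l≡j₀ = ℕ.≤-antisym (≡.subst (l ℕ.≤_) (≡.sym j₀≡J₀) (H-ends.≤max l Hl≉0)) (H-ends.min≤ l Hl≉0)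

    i₀<I₀ : i₀ ℕ.< I₀
    i₀<I₀ with ℕ.m≤n⇒m<n∨m≡n (G-ends.≤max i₀ G-ends.min∈)
    ... | inj₁ i₀<I₀ = i₀<I₀
    ... | inj₂ i₀≡I₀ =
      contradiction (≡.subst (2 ℕ.≤_) (≡.trans (≡.sym i₀≡I₀) (G-monomial⇒i₀≡1 i₀≡I₀)) G-ends.2≤max) λ { (s≤s ()) }

    j₀<J₀ : j₀ ℕ.< J₀
    j₀<J₀ with ℕ.m≤n⇒m<n∨m≡n (H-ends.≤max j₀ H-ends.min∈)
    ... | inj₁ j₀<J₀ = j₀<J₀
    ... | inj₂ j₀≡J₀ =
      contradiction (≡.subst (2 ℕ.≤_) (≡.trans (≡.sym j₀≡J₀) (H-monomial⇒j₀≡1 j₀≡J₀)) H-ends.2≤max) λ { (s≤s ()) }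

    module LowestPoint {F : ℕ → Carrier} (valued : Valued F) (F0≈0 : F 0 ≈ 0#) (poly : IsDirichletPoly R F)
                       {w : ℕ} (w∈ : Support F w) where
      open ValuedCoefficients valued

      weight-of : ℕ → Fraction
      weight-of j = weight j (ν j)

      positive : ∀ {j} → Support F j → Positive (weight-of j)
      positive {j} Fj≉0 = weight-positive (ν j) (support-positive F F0≈0 Fj≉0)

      private
        lowest = greatest-least support? (λ i j → weight-of i ≤ᶠ? weight-of j) ≤ᶠ-refl (λ i≰j → <ᶠ⇒≤ᶠ (≰ᶠ⇒>ᶠ i≰j))
                                (λ Fj≉0 → ≤ᶠ-trans (positive Fj≉0)) (proj₁ (support-bounded poly)) (proj₂ (support-bounded poly)) w∈

      T : ℕ
      T = proj₁ lowest

      T∈ : Support F T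
      T∈ = proj₁ (proj₁ (proj₂ lowest))

      T-lowest : ∀ j → Support F j → weight-of T ≤ᶠ weight-of j
      T-lowest = proj₂ (proj₁ (proj₂ lowest))

      T-rightmost : ∀ j → Support F j → weight-of j ≤ᶠ weight-of T → j ℕ.≤ T
      T-rightmost = proj₂ (proj₂ lowest)

      0<T : 0 ℕ.< T
      0<T = support-positive F F0≈0 T∈

    module G-lowest = LowestPoint valuedG G0≈0 G-poly G-ends.min∈
    module H-lowest = LowestPoint valuedH H0≈0 H-poly H-ends.min∈
    open G-lowest using () renaming (weight-of to wG)
    open H-lowest using () renaming (weight-of to wH)

    TG TH : ℕ
    TG = G-lowest.T
    TH = H-lowest.T

    V : ℕ
    V = G.ν TG ℕ.+ H.ν TH

    -- Minimal points j, l with j ≤ TG, l ≤ TH and j l = TG TH must be TG, TH themselves.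
    other-terms-heavier : ∀ j l → j ℕ.* l ≡ TG ℕ.* TH → j ≢ TG → Support G j → Support H l → V ℕ.< G.ν j ℕ.+ H.ν l
    other-terms-heavier j l jl≡k j≢TG Gj≉0 Hl≉0 = <ᶠ-same-index⇒< {TG ℕ.* TH} {V} {G.ν j ℕ.+ H.ν l}
      (≡.subst₂ _<ᶠ_ (≡.sym (weight-* TG TH (G.ν TG) (H.ν TH)))
                     (≡.trans (≡.sym (weight-* j l (G.ν j) (H.ν l))) (≡.cong (λ k → weight k (G.ν j ℕ.+ H.ν l)) jl≡k))
                     products)
      where
      products : wG TG · wH TH <ᶠ wG j · wH l
      products = by-cases (wG j ≤ᶠ? wG TG) (wH l ≤ᶠ? wH TH)
        where
        by-cases : Dec (wG j ≤ᶠ wG TG) → Dec (wH l ≤ᶠ wH TH) → wG TG · wH TH <ᶠ wG j · wH l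
        by-cases (yes j-low) (yes l-low) = contradiction jl≡k (ℕ.<⇒≢ (*-mono-<-≤ (ℕ.≤∧≢⇒< (G-lowest.T-rightmost j Gj≉0 j-low) j≢TG)
                                                                   (H-lowest.T-rightmost l Hl≉0 l-low) (support-positive H H0≈0 Hl≉0)))
        by-cases (no j-high) _           =
          ·-mono-<ᶠ-≤ᶠ (H-lowest.positive H-lowest.T∈) (H-lowest.positive Hl≉0) (≰ᶠ⇒>ᶠ j-high) (H-lowest.T-lowest l Hl≉0)
        by-cases (yes _)     (no l-high) =
          ·-mono-≤ᶠ-<ᶠ (G-lowest.positive G-lowest.T∈) (G-lowest.positive Gj≉0) (G-lowest.T-lowest j Gj≉0) (≰ᶠ⇒>ᶠ l-high)

    ν-at-TGTH : ν[ dmul R G H (TG ℕ.* TH) ]≡ V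
    ν-at-TGTH = ν-dmul TG TH G-lowest.0<T H-lowest.0<T G-lowest.T∈ H-lowest.T∈ other-terms-heavier

    1≤TGTH : 1 ℕ.≤ TG ℕ.* TH
    1≤TGTH = ℕ.*-mono-≤ G-lowest.0<T H-lowest.0<T

    a-TGTH≉0 : ¬ (a (TG ℕ.* TH) ≈ 0#)
    a-TGTH≉0 = ν⇒a≉0 1≤TGTH ν-at-TGTH

    on-or-above-segment : ∀ {k v} → ¬ (a k ≈ 0#) → ν[ a k ]≡ v → weight m vm ≤ᶠ weight k v
    on-or-above-segment {k} {v} ak≉0 νak
      with ℕ.m≤n⇒m<n∨m≡n (proj₁ (support-a k ak≉0)) | ℕ.m≤n⇒m<n∨m≡n (proj₂ (support-a k ak≉0))
    ... | inj₂ ≡.refl | _           = ≡.subst (λ u → weight m vm ≤ᶠ weight m u) (ν-unique νm νak) ≤ᶠ-refl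
    ... | inj₁ _      | inj₂ ≡.refl = ≡.subst (λ u → weight m vm ≤ᶠ weight n u) (ν-unique νn νak) (proj₁ weight-ends)
    ... | inj₁ m<k    | inj₁ k<n    =
      <ᶠ⇒≤ᶠ (zpow-<⇒weight-< (ℕ.<-trans (ℕ.<-≤-trans (s≤s z≤n) 1≤m) m<k) (above-segment k v m<k k<n ak≉0 (ν⇒HasVal νak)))

    -- The term at TG TH is at least as heavy as the segment, on which the end terms of B·a lie;
    -- these are products of end terms of G and H, which therefore have minimal weight too.
    contradiction-at-TGTH : ∀ {v} → ν[ a (TG ℕ.* TH) ]≡ v → ⊥
    contradiction-at-TGTH {v} νak =
      slope-contradiction {i₀} {I₀} {j₀} {J₀} {α₀} {A₀} {β₀} {B₀} {γ}
        vn≢vm G-ends.0<min i₀<I₀ H-ends.0<min j₀<J₀ γ+vm≡α₀+β₀ γ+vn≡A₀+B₀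
        (≤ᶠ-trans (G-lowest.positive G-lowest.T∈) (proj₁ lowest-at-m) (G-lowest.T-lowest I₀ G-ends.max∈) ,
         ≤ᶠ-trans (G-lowest.positive G-lowest.T∈) (proj₁ lowest-at-n) (G-lowest.T-lowest i₀ G-ends.min∈))
        (≤ᶠ-trans (H-lowest.positive H-lowest.T∈) (proj₂ lowest-at-m) (H-lowest.T-lowest J₀ H-ends.max∈) ,
         ≤ᶠ-trans (H-lowest.positive H-lowest.T∈) (proj₂ lowest-at-n) (H-lowest.T-lowest j₀ H-ends.min∈))
        coprime
      where
      TGTH-weight : weight (TG ℕ.* TH) (γ ℕ.+ v) ≡ wG TG · wH TH
      TGTH-weight = ≡.trans (≡.cong (weight (TG ℕ.* TH)) (ν-unique (ν-* νB νak) (ν-Ba 1≤TGTH ν-at-TGTH)))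
                           (weight-* TG TH (G.ν TG) (H.ν TH))
      below-TGTH : ∀ {k vk} → weight k vk ≤ᶠ weight m vm → weight k (γ ℕ.+ vk) ≤ᶠ wG TG · wH TH
      below-TGTH {k} {vk} k≤m = ≡.subst (weight k (γ ℕ.+ vk) ≤ᶠ_) TGTH-weight
        (weight-shift-≤ᶠ γ (≤ᶠ-trans (weight-positive vm (ℕ.<-≤-trans (s≤s z≤n) 1≤m)) k≤m (on-or-above-segment a-TGTH≉0 νak)))
      lowest-at-m : wG i₀ ≤ᶠ wG TG × wH j₀ ≤ᶠ wH TH
      lowest-at-m = ·-≤ᶠ-cancel (G-lowest.positive G-ends.min∈) (G-lowest.positive G-lowest.T∈)
                                (H-lowest.positive H-ends.min∈) (H-lowest.positive H-lowest.T∈)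
        (G-lowest.T-lowest i₀ G-ends.min∈) (H-lowest.T-lowest j₀ H-ends.min∈)
        (≡.subst (_≤ᶠ wG TG · wH TH) (≡.trans (≡.cong₂ weight m≡i₀j₀ γ+vm≡α₀+β₀) (weight-* i₀ j₀ α₀ β₀))
                 (below-TGTH ≤ᶠ-refl))
      lowest-at-n : wG I₀ ≤ᶠ wG TG × wH J₀ ≤ᶠ wH TH
      lowest-at-n = ·-≤ᶠ-cancel (G-lowest.positive G-ends.max∈) (G-lowest.positive G-lowest.T∈)
                                (H-lowest.positive H-ends.max∈) (H-lowest.positive H-lowest.T∈)
        (G-lowest.T-lowest I₀ G-ends.max∈) (H-lowest.T-lowest J₀ H-ends.max∈)
        (≡.subst (_≤ᶠ wG TG · wH TH) (≡.trans (≡.cong₂ weight n≡I₀J₀ γ+vn≡A₀+B₀) (weight-* I₀ J₀ A₀ B₀))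
                 (below-TGTH (proj₂ weight-ends)))

open import Level using (Level)
open import Algebra.Bundles using (CommutativeRing)
open import Data.Nat using (ℕ; _<_; _≤_; _*_)
open import Data.Nat.Divisibility using (_∣_)
open import Data.Nat.Primality using (Prime)
open import Data.Integer using (∣_∣; _⊖_)
open import Data.Rational using (_>_)
open import Data.Product using (_×_; _,_)
open import Relation.Nullary using (¬_)
open import Relation.Binary.PropositionalEquality using (_≡_; _≢_)

theorem3p4 : ∀ {c ℓ c' ℓ' : Level} (R : CommutativeRing c ℓ) → IsUFD R →
    (K : CommutativeRing c' ℓ') (ι : CommutativeRing.Carrier R → CommutativeRing.Carrier K) →
    IsFractionField R K ι →
    (a : ℕ → CommutativeRing.Carrier R) (m n : ℕ) → 1 ≤ m → m ≤ n →
    ¬ (CommutativeRing._≈_ R (a m) (CommutativeRing.0# R)) →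
    ¬ (CommutativeRing._≈_ R (a n) (CommutativeRing.0# R)) →
    (∀ i → ¬ (CommutativeRing._≈_ R (a i) (CommutativeRing.0# R)) → m ≤ i × i ≤ n) →
    (∀ d → (∀ i → ¬ (CommutativeRing._≈_ R (a i) (CommutativeRing.0# R)) → d ∣ i) → d ≡ 1) →
    (p : CommutativeRing.Carrier R) → IsPrimeElt R p →
    (vm vn : ℕ) → HasVal R p (a m) vm → HasVal R p (a n) vn →
    vn ≢ vm →
    (∀ i vi → m < i → i < n → ¬ (CommutativeRing._≈_ R (a i) (CommutativeRing.0# R)) →
      HasVal R p (a i) vi → zpow n i (vi ⊖ vm) > zpow m i (vi ⊖ vn)) →
    (∀ d → d ∣ ∣ vn ⊖ vm ∣ →
      (∀ q → Prime q → q ∣ m * n → ∀ en em → HasValℕ q n en → HasValℕ q m em →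
        d ∣ ∣ en ⊖ em ∣) →
      d ≡ 1) →
    IrreducibleOver K (λ i → ι (a i))
theorem3p4 R ufd K ι fractionField a m n 1≤m m≤n am≉0 an≉0 support-a indices-coprime p prime vm vn νm νn vn≢vm
  above-segment exponents-coprime (g , h , g-poly , h-poly , g-nonconstant , h-nonconstant , ιa≈g*h) =
  valued G-poly λ valuedG → valued H-poly λ valuedH → ν-exists B≉0 λ (γ , νB) →
    let open NoFactorisation a m n 1≤m m≤n am≉0 an≉0 support-a indices-coprime vm vn (HasVal⇒ν νm) (HasVal⇒ν νn) vn≢vm
                      above-segment exponents-coprime F valuedG valuedH γ νB
    in ν-exists a-TGTH≉0 λ (_ , νak) → contradiction-at-TGTH νak
  where
  domain = IsUFD.domain ufd
  F = ClearingDenominators.clear-denominators R domain K ι fractionField a g h g-poly h-poly g-nonconstant h-nonconstant ιa≈g*h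
  open ScaledFactorisation F
  open ValuationExistence R ufd p prime using (ν-exists; valued)
  open PAdicValuation R domain p prime using (HasVal⇒ν)
  open NewtonPolygon R domain p prime using (module NoFactorisation)
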